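{- (i) (Odd.) For all $n\ge1$, $\Lambda_{2n+1}$ is the union of the three consecutive, disjoint integer intervals $\Lambda^{(a)}_{2n-1}=\Lambda_{2n-1}+L_{2n}$, $\Lambda^{(b)}_{2n-2}=\Lambda_{2n-2}+L_{2n+1}$, $\Lambda^{(c)}_{2n-1}=\Lambda_{2n-1}+L_{2n+1}$, and $$\beta(N)=1000\,(10)^{ -1}\beta(N-L_{2n})(01)^{ -1}1001\ \ (N\in\Lambda^{(a)}_{2n-1}),$$ $$\beta(N)=100\,\beta(N-L_{2n+1})(01)^{ -1}001001\ \ (N\in\Lambda^{(b)}_{2n-2}),$$ $$\beta(N)=10\,\beta(N-L_{2n+1})(01)^{ -1}0001\ \ (N\in\Lambda^{(c)}_{2n-1}).$$ (ii) (Even.) For all $n\ge1$, $\Lambda_{2n+2}$ is the union of the three consecutive, disjoint integer intervals $\Lambda^{(a)}_{2n}=\Lambda_{2n}+L_{2n+1}$, $\Lambda^{(b)}_{2n-1}=\Lambda_{2n-1}+L_{2n+2}$, $\Lambda^{(c)}_{2n}=\Lambda_{2n}+L_{2n+2}$, and $$\beta(N)=1000\,(10)^{ -1}\beta(N-L_{2n+1})(01)^{ -1}0001\ \ (N\in\Lambda^{(a)}_{2n}),$$ $$\beta(N)=100\,\beta(N-L_{2n+2})\,01\ \ (N\in\Lambda^{(b)}_{2n-1}),$$ $$\beta(N)=10\,\beta(N-L_{2n+1})\,01\ \ (N\in\Lambda^{(c)}_{2n}).$$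
   Context: Let $\varphi=(1+\sqrt5)/2$. Every integer $N\ge1$ has a unique base phi expansion $N=\sum_{i\in\mathbb Z} d_i\varphi^i$ with $d_i\in\{0,1\}$, finitely many nonzero, and $d_id_{i+1}=0$ for all $i$; writing $L$ (resp. $R$) for the largest (resp. smallest) index with $d_i=1$, $\beta(N)$ is the word $d_L\cdots d_1d_0\cdot d_{ -1}\cdots d_R$ with a radix point "$\cdot$" between $d_0$ and $d_{ -1}$ (if $R\ge0$ nothing follows the point). Lucas numbers: $L_0=2$, $L_1=1$, $L_n=L_{n-1}+L_{n-2}$. Lucas intervals (integer intervals): $\Lambda_{2n}=[L_{2n},L_{2n+1}]$, $\Lambda_{2n+1}=[L_{2n+1}+1,L_{2n+2}-1]$ for $n\ge0$ (so $\Lambda_0=\emptyset$). For a set $A$ of integers and an integer $x$, $A+x=\{a+x:a\in A\}$. Products of words are computed in the free group on $\{0,1\}$, with the radix point treated as an extra letter that is never cancelled; e.g. $(01)^{ -1}0001=1^{ -1}001$, and $u^{ -1}$ cancels against the matching letters adjacent to it. -}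

module Defs where

open import Data.Nat using (ℕ; zero; suc; _+_; _*_; _∸_; _≤_; _<_; _%_; _/_)
open import Data.Integer as ℤ using (ℤ; +_)
open import Data.Bool using (Bool; true; false)
open import Data.List using (List; []; _∷_; _++_; map; reverse; foldl; foldr)
open import Data.Product using (_×_; _,_; Σ; Σ-syntax)
open import Data.Unit using (⊤)
open import Data.Empty using (⊥)
open import Relation.Binary.PropositionalEquality using (_≡_)

L : ℕ → ℕ
L zero = 2
L (suc zero) = 1
L (suc (suc n)) = L (suc n) + L n

ΛEven : ℕ → ℕ → Set
ΛEven m N = L (2 * m) ≤ N × N ≤ L (suc (2 * m))

ΛOdd : ℕ → ℕ → Set
ΛOdd m N = suc (L (suc (2 * m))) ≤ N × suc N ≤ L (suc (suc (2 * m)))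

Λ : ℕ → ℕ → Set
Λ k N with k % 2
... | zero  = ΛEven (k / 2) N
... | suc _ = ΛOdd (k / 2) N

_∈Λ_+_ : ℕ → ℕ → ℕ → Set
N ∈Λ k + x = x ≤ N × Λ k (N ∸ x)

-- The ring ℤ[φ]: a pair (a , b) stands for a + b φ, where φ² = φ + 1.

ℤφ : Set
ℤφ = ℤ × ℤ

zφ : ℤφ
zφ = (+ 0 , + 0)

addφ : ℤφ → ℤφ → ℤφ
addφ (a , b) (c , d) = (a ℤ.+ c , b ℤ.+ d)

-- multiplication by φ : (a + bφ)φ = b + (a+b)φ
mulφ : ℤφ → ℤφ
mulφ (a , b) = (b , a ℤ.+ b)

-- multiplication by φ⁻¹ = φ - 1 : (a + bφ)(φ - 1) = (b - a) + aφ
divφ : ℤφ → ℤφ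
divφ (a , b) = (b ℤ.- a , a)

digit : Bool → ℤφ
digit true  = (+ 1 , + 0)
digit false = zφ

-- value of d_L ⋯ d_0 (list given most significant digit first)
intVal : List Bool → ℤφ
intVal = foldl (λ acc d → addφ (mulφ acc) (digit d)) zφ

-- value of · d_{-1} ⋯ d_R (list given as d_{-1}, d_{-2}, …, d_R)
fracVal : List Bool → ℤφ
fracVal = foldr (λ d acc → divφ (addφ (digit d) acc)) zφ

NoAdj11 : List Bool → Set
NoAdj11 [] = ⊤
NoAdj11 (d ∷ []) = ⊤
NoAdj11 (true ∷ true ∷ ds) = ⊥
NoAdj11 (_ ∷ d ∷ ds) = NoAdj11 (d ∷ ds)

HeadOne : List Bool → Set
HeadOne [] = ⊥
HeadOne (d ∷ _) = d ≡ true

LastOneOrEmpty : List Bool → Set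
LastOneOrEmpty [] = ⊤
LastOneOrEmpty (d ∷ []) = d ≡ true
LastOneOrEmpty (_ ∷ d ∷ ds) = LastOneOrEmpty (d ∷ ds)

data Letter : Set where
  ₀ ₁ ∙ : Letter

bit : Bool → Letter
bit true  = ₁
bit false = ₀

expWord : List Bool → List Bool → List Letter
expWord ip fp = map bit ip ++ (∙ ∷ map bit fp)

-- IsBeta N w : w is the base-phi expansion word β(N) of N
-- (integer digits ip = d_L ⋯ d_0 with d_L = 1, fractional digits
--  fp = d_{-1} ⋯ d_R, empty or ending in d_R = 1, no two adjacent ones,
--  and Σ d_i φ^i = N, computed exactly in ℤ[φ]).
IsBeta : ℕ → List Letter → Set
IsBeta N w =
  Σ[ ip ∈ List Bool ] Σ[ fp ∈ List Bool ]
    HeadOne ip × LastOneOrEmpty fp × NoAdj11 (ip ++ fp) ×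
    addφ (intVal ip) (fracVal fp) ≡ (+ N , + 0) ×
    w ≡ expWord ip fp

-- Free group on {0,1} with the radix point as an extra never-cancelled
-- letter. Elements are lists of signed letters; `reduce` computes the
-- freely reduced form.

data Sym : Set where
  pos : Letter → Sym
  neg : Letter → Sym

consR : Sym → List Sym → List Sym
consR (pos ₀) (neg ₀ ∷ r) = r
consR (pos ₁) (neg ₁ ∷ r) = r
consR (neg ₀) (pos ₀ ∷ r) = r
consR (neg ₁) (pos ₁ ∷ r) = r
consR s r = s ∷ r

reduce : List Sym → List Sym
reduce = foldr consR []

⟦_⟧ : List Letter → List Sym
⟦ w ⟧ = map pos w

⟦_⟧⁻¹ : List Letter → List Sym
⟦ w ⟧⁻¹ = reverse (map neg w)

prod : List (List Sym) → List Sym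
prod fs = reduce (foldr _++_ [] fs)

-- "β(N) = g": the reduced free-group element g is the (positive) word β(N)
BetaEq : ℕ → List Sym → Set
BetaEq N g = Σ[ v ∈ List Letter ] IsBeta N v × g ≡ ⟦ v ⟧

-- Write β (M) = ip · fp.  Multiplying the expansion by φ ^ |fp| makes it an integer combination of
-- Fibonacci numbers, so M · F (|fp| + 2) is a Zeckendorf sum lying between two consecutive Fibonacci
-- numbers, while the vanishing φ-coordinate of M equates the Fibonacci sum of ip with an alternating
-- Fibonacci sum of the reversed fraction.  Played against each other, and against d'Ocagne's identity
-- L a · F (a + c) = F (2a + c) + (-1) ^ a F c, these bounds show that the lengths of ip and fp are fixed by
-- the Lucas interval Λ k containing M, and that fp ends in 01 (in 001 when k is odd and at least 3).
-- Since L k = φ ^ k + (-φ) ^ -k, adding a Lucas number to M then only splices the digits of φ ^ k and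
-- ± φ ^ -k onto the two ends of β (M), which is what the six formulas do; the interval statements are
-- arithmetic with the endpoints L k (+ 1 for odd k).

module Submission where

open import Defs
open import Data.Bool using (Bool; true; false)
open import Data.Empty using (⊥; ⊥-elim)
open import Data.Integer as ℤ using (ℤ; +_; -_; +≤+; +<+)
import Data.Integer.Properties as ℤₚ
open import Data.Integer.Tactic.RingSolver using () renaming (solve-∀ to ℤ-solve)
open import Data.List using (List; []; _∷_; _++_; length; map; reverse; foldl; foldr)
import Data.List.Properties as Listₚ
open import Data.Nat using (ℕ; zero; suc; _+_; _*_; _∸_; _≤_; _<_; z≤n; s≤s; _%_; _/_; _≤′_; ≤′-refl; ≤′-step)
import Data.Nat.DivMod as ℕ
import Data.Nat.Properties as ℕₚ
open import Data.Nat.Tactic.RingSolver using () renaming (solve-∀ to ℕ-solve)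
open import Data.Product using (_×_; _,_; proj₁; proj₂; Σ-syntax; uncurry)
open import Data.Sum using (_⊎_; inj₁; inj₂)
open import Data.Sum.Function.Propositional using (_⊎-⇔_)
open import Data.Unit using (tt)
open import Function.Bundles using (_⇔_; mk⇔; Equivalence)
open import Function.Construct.Composition using (_⇔-∘_)
open import Function.Construct.Symmetry using (⇔-sym)
open import Relation.Binary.Definitions using (tri<; tri≈; tri>)
open import Relation.Binary.PropositionalEquality
open import Relation.Nullary using (¬_)

-- Unlike 2 * j, dbl (suc j) reduces to suc (suc (dbl j)), so lengths and indices built from it unify.
dbl : ℕ → ℕ
dbl zero    = zero
dbl (suc j) = suc (suc (dbl j))

parity : ∀ n → Σ[ j ∈ ℕ ] (n ≡ dbl j ⊎ n ≡ suc (dbl j))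
parity zero = 0 , inj₁ refl
parity (suc n) with parity n
... | j , inj₁ e = j , inj₂ (cong suc e)
... | j , inj₂ e = suc j , inj₁ (cong suc e)

dbl-mono-≤ : ∀ {i j} → i ≤ j → dbl i ≤ dbl j
dbl-mono-≤ z≤n     = z≤n
dbl-mono-≤ (s≤s p) = s≤s (s≤s (dbl-mono-≤ p))

dbl-cancel-≤ : ∀ {i j} → dbl i ≤ dbl j → i ≤ j
dbl-cancel-≤ {zero}          _             = z≤n
dbl-cancel-≤ {suc i} {suc j} (s≤s (s≤s p)) = s≤s (dbl-cancel-≤ p)

dbl≤suc-dbl⇒≤ : ∀ {i j} → dbl i ≤ suc (dbl j) → i ≤ j
dbl≤suc-dbl⇒≤ {zero}          _             = z≤n
dbl≤suc-dbl⇒≤ {suc i} {suc j} (s≤s (s≤s p)) = s≤s (dbl≤suc-dbl⇒≤ p)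

dbl-injective : ∀ {i j} → dbl i ≡ dbl j → i ≡ j
dbl-injective {zero}  {zero}  _ = refl
dbl-injective {suc i} {suc j} e = cong suc (dbl-injective (ℕₚ.suc-injective (ℕₚ.suc-injective e)))

suc-dbl≢dbl : ∀ i j → suc (dbl i) ≢ dbl j
suc-dbl≢dbl i       zero    ()
suc-dbl≢dbl zero    (suc j) ()
suc-dbl≢dbl (suc i) (suc j) e = suc-dbl≢dbl i j (ℕₚ.suc-injective (ℕₚ.suc-injective e))

2*≡dbl : ∀ j → 2 * j ≡ dbl j
2*≡dbl zero    = refl
2*≡dbl (suc j) = trans (ℕₚ.*-distribˡ-+ 2 1 j) (cong (λ z → suc (suc z)) (2*≡dbl j))

%2≤1 : ∀ k → k % 2 ≤ 1
%2≤1 k = ℕₚ.≤-pred (ℕ.m%n<n k 2)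

dbl%2 : ∀ j → dbl j % 2 ≡ 0
dbl%2 zero    = refl
dbl%2 (suc j) = dbl%2 j

suc-dbl%2 : ∀ j → suc (dbl j) % 2 ≡ 1
suc-dbl%2 zero    = refl
suc-dbl%2 (suc j) = suc-dbl%2 j

/2-suc-suc : ∀ n → suc (suc n) / 2 ≡ suc (n / 2)
/2-suc-suc n = ℕ.m/n≡1+[m∸n]/n {suc (suc n)} {2} (s≤s (s≤s z≤n))

dbl/2 : ∀ j → dbl j / 2 ≡ j
dbl/2 zero    = refl
dbl/2 (suc j) = trans (/2-suc-suc (dbl j)) (cong suc (dbl/2 j))

suc-dbl/2 : ∀ j → suc (dbl j) / 2 ≡ j
suc-dbl/2 zero    = refl
suc-dbl/2 (suc j) = trans (/2-suc-suc (suc (dbl j))) (cong suc (suc-dbl/2 j))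

F : ℕ → ℕ
F zero          = 0
F (suc zero)    = 1
F (suc (suc n)) = F (suc n) + F n

-- F (k - 1), with the convention F (-1) = 1.
Fpred : ℕ → ℕ
Fpred zero    = 1
Fpred (suc n) = F n

F-suc : ∀ k → F (suc k) ≡ Fpred k + F k
F-suc zero    = refl
F-suc (suc k) = ℕₚ.+-comm (F (suc k)) (F k)

F-suc-suc : ∀ k → F (suc (suc k)) ≡ Fpred k + 2 * F k
F-suc-suc k = begin
  F (suc k) + F k                ≡⟨ cong (_+ F k) (F-suc k) ⟩
  Fpred k + F k + F k            ≡⟨ ring (Fpred k) (F k) ⟩
  Fpred k + 2 * F k              ∎
  where
  open ≡-Reasoning
  ring : ∀ g f → g + f + f ≡ g + 2 * f
  ring = ℕ-solve

F-≤-suc : ∀ k → F k ≤ F (suc k)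
F-≤-suc zero    = z≤n
F-≤-suc (suc k) = ℕₚ.m≤m+n (F (suc k)) (F k)

F-mono-≤ : ∀ {a b} → a ≤ b → F a ≤ F b
F-mono-≤ a≤b = go (ℕₚ.≤⇒≤′ a≤b)
  where
  go : ∀ {a b} → a ≤′ b → F a ≤ F b
  go ≤′-refl       = ℕₚ.≤-refl
  go (≤′-step {n} a≤b) = ℕₚ.≤-trans (go a≤b) (F-≤-suc n)

F-suc-positive : ∀ k → 1 ≤ F (suc k)
F-suc-positive zero    = s≤s z≤n
F-suc-positive (suc k) = ℕₚ.≤-trans (F-suc-positive k) (ℕₚ.m≤m+n (F (suc k)) (F k))

F-cancel-< : ∀ {a b} → F a < F b → a < b
F-cancel-< {a} {b} Fa<Fb with ℕₚ.<-≤-connex a b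
... | inj₁ a<b = a<b
... | inj₂ b≤a = ⊥-elim (ℕₚ.<⇒≱ Fa<Fb (F-mono-≤ b≤a))

F-+ : ∀ a b → F (a + b) ≡ F a * F (suc b) + Fpred a * F b
F-+ zero    b = sym (ℕₚ.+-identityʳ (F b))
F-+ (suc a) b = begin
  F (suc a + b)                               ≡⟨ cong F (sym (ℕₚ.+-suc a b)) ⟩
  F (a + suc b)                               ≡⟨ F-+ a (suc b) ⟩
  F a * (F (suc b) + F b) + Fpred a * F (suc b) ≡⟨ ring (F a) (Fpred a) (F (suc b)) (F b) ⟩
  (Fpred a + F a) * F (suc b) + F a * F b     ≡⟨ cong (λ z → z * F (suc b) + F a * F b) (sym (F-suc a)) ⟩
  F (suc a) * F (suc b) + Fpred (suc a) * F b ∎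
  where
  open ≡-Reasoning
  ring : ∀ x g y z → x * (y + z) + g * y ≡ (g + x) * y + x * z
  ring = ℕ-solve

L≡F+Fpred : ∀ a → L a ≡ F (suc a) + Fpred a
L≡F+Fpred zero          = refl
L≡F+Fpred (suc zero)    = refl
L≡F+Fpred (suc (suc a)) = begin
  L (suc a) + L a                                 ≡⟨ cong₂ _+_ (L≡F+Fpred (suc a)) (L≡F+Fpred a) ⟩
  (F (suc (suc a)) + F a) + (F (suc a) + Fpred a) ≡⟨ ring (F (suc (suc a))) (F a) (F (suc a)) (Fpred a) ⟩
  (F (suc (suc a)) + F (suc a)) + (Fpred a + F a) ≡⟨ cong (_+_ (F (suc (suc a)) + F (suc a))) (sym (F-suc a)) ⟩
  F (suc (suc (suc a))) + Fpred (suc (suc a))     ∎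
  where
  open ≡-Reasoning
  ring : ∀ p q s g → (p + q) + (s + g) ≡ (p + s) + (g + q)
  ring = ℕ-solve

-- d'Ocagne's identity F (a+1) F (a+c) - F a F (a+c+1) = (-1)^a F c, split by the parity of a.
mutual
  dOcagne-even : ∀ j c → F (suc (dbl j)) * F (dbl j + c) ≡ F (dbl j) * F (suc (dbl j + c)) + F c
  dOcagne-even zero    c = ℕₚ.*-identityˡ (F c)
  dOcagne-even (suc j) c = step (F (suc (suc (dbl j)))) (F (suc (dbl j))) (F (suc (dbl j + c)))
                                (F (suc (suc (dbl j + c)))) (F c) (dOcagne-odd j c)
    where
    step : ∀ p q u v f → p * u + f ≡ q * v → (p + q) * v ≡ p * (v + u) + f
    step p q u v f h = begin
      (p + q) * v         ≡⟨ ℕₚ.*-distribʳ-+ v p q ⟩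
      p * v + q * v       ≡⟨ cong (_+_ (p * v)) (sym h) ⟩
      p * v + (p * u + f) ≡⟨ ring p u v f ⟩
      p * (v + u) + f     ∎
      where
      open ≡-Reasoning
      ring : ∀ p u v f → p * v + (p * u + f) ≡ p * (v + u) + f
      ring = ℕ-solve

  dOcagne-odd : ∀ j c → F (suc (suc (dbl j))) * F (suc (dbl j) + c) + F c ≡ F (suc (dbl j)) * F (suc (suc (dbl j) + c))
  dOcagne-odd j c = step (F (suc (dbl j))) (F (dbl j)) (F (dbl j + c)) (F (suc (dbl j + c))) (F c) (dOcagne-even j c)
    where
    step : ∀ p q u v f → p * u ≡ q * v + f → (p + q) * v + f ≡ p * (v + u)
    step p q u v f h = begin
      (p + q) * v + f     ≡⟨ ring p q v f ⟩
      p * v + (q * v + f) ≡⟨ cong (_+_ (p * v)) (sym h) ⟩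
      p * v + p * u       ≡⟨ sym (ℕₚ.*-distribˡ-+ p v u) ⟩
      p * (v + u)         ∎
      where
      open ≡-Reasoning
      ring : ∀ p q v f → (p + q) * v + f ≡ p * v + (q * v + f)
      ring = ℕ-solve

L-even-*-F : ∀ j c → L (dbl j) * F (dbl j + c) ≡ F (dbl j + (dbl j + c)) + F c
L-even-*-F j c = begin
  L a * F (a + c)                                  ≡⟨ cong (_* F (a + c)) (L≡F+Fpred a) ⟩
  (F (suc a) + Fpred a) * F (a + c)                ≡⟨ ℕₚ.*-distribʳ-+ (F (a + c)) (F (suc a)) (Fpred a) ⟩
  F (suc a) * F (a + c) + Fpred a * F (a + c)      ≡⟨ cong (_+ Fpred a * F (a + c)) (dOcagne-even j c) ⟩
  F a * F (suc (a + c)) + F c + Fpred a * F (a + c) ≡⟨ ring (F a * F (suc (a + c))) (F c) (Fpred a * F (a + c)) ⟩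
  F a * F (suc (a + c)) + Fpred a * F (a + c) + F c ≡⟨ cong (_+ F c) (sym (F-+ a (a + c))) ⟩
  F (a + (a + c)) + F c                            ∎
  where
  open ≡-Reasoning
  a = dbl j
  ring : ∀ x y z → x + y + z ≡ x + z + y
  ring = ℕ-solve

L-odd-*-F : ∀ j c → L (suc (dbl j)) * F (suc (dbl j) + c) + F c ≡ F (suc (dbl j) + (suc (dbl j) + c))
L-odd-*-F j c = begin
  L a * F (a + c) + F c                             ≡⟨ cong (λ z → z * F (a + c) + F c) (L≡F+Fpred a) ⟩
  (F (suc a) + Fpred a) * F (a + c) + F c           ≡⟨ ring (F (suc a)) (Fpred a) (F (a + c)) (F c) ⟩
  (F (suc a) * F (a + c) + F c) + Fpred a * F (a + c) ≡⟨ cong (_+ Fpred a * F (a + c)) (dOcagne-odd j c) ⟩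
  F a * F (suc (a + c)) + Fpred a * F (a + c)       ≡⟨ sym (F-+ a (a + c)) ⟩
  F (a + (a + c))                                   ∎
  where
  open ≡-Reasoning
  a = suc (dbl j)
  ring : ∀ x g y z → (x + g) * y + z ≡ (x * y + z) + g * y
  ring = ℕ-solve

L-positive : ∀ k → 1 ≤ L k
L-positive zero          = s≤s z≤n
L-positive (suc zero)    = s≤s z≤n
L-positive (suc (suc k)) = ℕₚ.≤-trans (L-positive (suc k)) (ℕₚ.m≤m+n _ _)

-- Arithmetic in ℤ[φ]

mulφ^ : ℕ → ℤφ → ℤφ
mulφ^ zero    x = x
mulφ^ (suc k) x = mulφ (mulφ^ k x)

divφ^ : ℕ → ℤφ → ℤφ
divφ^ zero    x = x
divφ^ (suc k) x = divφ (divφ^ k x)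

negφ : ℤφ → ℤφ
negφ (a , b) = (- a , - b)

oneφ : ℤφ
oneφ = (+ 1 , + 0)

addφ-assoc : ∀ x y z → addφ (addφ x y) z ≡ addφ x (addφ y z)
addφ-assoc (a , b) (c , d) (e , f) = cong₂ _,_ (ℤₚ.+-assoc a c e) (ℤₚ.+-assoc b d f)

addφ-identityˡ : ∀ x → addφ zφ x ≡ x
addφ-identityˡ (a , b) = cong₂ _,_ (ℤₚ.+-identityˡ a) (ℤₚ.+-identityˡ b)

addφ-identityʳ : ∀ x → addφ x zφ ≡ x
addφ-identityʳ (a , b) = cong₂ _,_ (ℤₚ.+-identityʳ a) (ℤₚ.+-identityʳ b)

mulφ-distrib : ∀ x y → mulφ (addφ x y) ≡ addφ (mulφ x) (mulφ y)
mulφ-distrib (a , b) (c , d) = cong (_ ,_) (ring a b c d)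
  where
  ring : ∀ a b c d → (a ℤ.+ c) ℤ.+ (b ℤ.+ d) ≡ (a ℤ.+ b) ℤ.+ (c ℤ.+ d)
  ring = ℤ-solve

divφ-distrib : ∀ x y → divφ (addφ x y) ≡ addφ (divφ x) (divφ y)
divφ-distrib (a , b) (c , d) = cong (_, _) (ring a b c d)
  where
  ring : ∀ a b c d → (b ℤ.+ d) ℤ.- (a ℤ.+ c) ≡ (b ℤ.- a) ℤ.+ (d ℤ.- c)
  ring = ℤ-solve

divφ-negφ : ∀ x → divφ (negφ x) ≡ negφ (divφ x)
divφ-negφ (a , b) = cong (_, _) (ring a b)
  where
  ring : ∀ a b → (- b) ℤ.- (- a) ≡ - (b ℤ.- a)
  ring = ℤ-solve

mulφ-inverseˡ : ∀ x → mulφ (divφ x) ≡ x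
mulφ-inverseˡ (a , b) = cong (_ ,_) (ring a b)
  where
  ring : ∀ a b → (b ℤ.- a) ℤ.+ a ≡ b
  ring = ℤ-solve

mulφ^-distrib : ∀ k x y → mulφ^ k (addφ x y) ≡ addφ (mulφ^ k x) (mulφ^ k y)
mulφ^-distrib zero    x y = refl
mulφ^-distrib (suc k) x y = trans (cong mulφ (mulφ^-distrib k x y)) (mulφ-distrib (mulφ^ k x) (mulφ^ k y))

divφ^-distrib : ∀ k x y → divφ^ k (addφ x y) ≡ addφ (divφ^ k x) (divφ^ k y)
divφ^-distrib zero    x y = refl
divφ^-distrib (suc k) x y = trans (cong divφ (divφ^-distrib k x y)) (divφ-distrib (divφ^ k x) (divφ^ k y))

divφ^-negφ : ∀ k x → divφ^ k (negφ x) ≡ negφ (divφ^ k x)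
divφ^-negφ zero    x = refl
divφ^-negφ (suc k) x = trans (cong divφ (divφ^-negφ k x)) (divφ-negφ (divφ^ k x))

mulφ^-suc : ∀ k x → mulφ^ (suc k) x ≡ mulφ^ k (mulφ x)
mulφ^-suc zero    x = refl
mulφ^-suc (suc k) x = cong mulφ (mulφ^-suc k x)

divφ^-suc : ∀ k x → divφ^ (suc k) x ≡ divφ^ k (divφ x)
divφ^-suc zero    x = refl
divφ^-suc (suc k) x = cong divφ (divφ^-suc k x)

mulφ^-+ : ∀ a b x → mulφ^ (a + b) x ≡ mulφ^ b (mulφ^ a x)
mulφ^-+ zero    b x = refl
mulφ^-+ (suc a) b x = trans (cong mulφ (mulφ^-+ a b x)) (mulφ^-suc b (mulφ^ a x))

divφ^-+ : ∀ a b x → divφ^ (a + b) x ≡ divφ^ b (divφ^ a x)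
divφ^-+ zero    b x = refl
divφ^-+ (suc a) b x = trans (cong divφ (divφ^-+ a b x)) (divφ^-suc b (divφ^ a x))

divφ^-zφ : ∀ k → divφ^ k zφ ≡ zφ
divφ^-zφ zero = refl
divφ^-zφ (suc k) rewrite divφ^-zφ k = refl

value : List Bool → List Bool → ℤφ
value ip fp = addφ (intVal ip) (fracVal fp)

private
  shiftIn : ℤφ → Bool → ℤφ
  shiftIn acc d = addφ (mulφ acc) (digit d)

  foldl-shiftIn : ∀ acc ys → foldl shiftIn acc ys ≡ addφ (mulφ^ (length ys) acc) (intVal ys)
  foldl-shiftIn acc []       = sym (addφ-identityʳ acc)
  foldl-shiftIn acc (y ∷ ys) = begin
    foldl shiftIn (shiftIn acc y) ys
      ≡⟨ foldl-shiftIn (shiftIn acc y) ys ⟩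
    addφ (mulφ^ n (addφ (mulφ acc) (digit y))) (intVal ys)
      ≡⟨ cong (λ z → addφ z (intVal ys)) (mulφ^-distrib n (mulφ acc) (digit y)) ⟩
    addφ (addφ (mulφ^ n (mulφ acc)) (mulφ^ n (digit y))) (intVal ys)
      ≡⟨ addφ-assoc (mulφ^ n (mulφ acc)) (mulφ^ n (digit y)) (intVal ys) ⟩
    addφ (mulφ^ n (mulφ acc)) (addφ (mulφ^ n (digit y)) (intVal ys))
      ≡⟨ cong₂ addφ (sym (mulφ^-suc n acc)) (sym (foldl-shiftIn (digit y) ys)) ⟩
    addφ (mulφ^ (suc n) acc) (foldl shiftIn (digit y) ys)
      ≡⟨ cong (λ z → addφ (mulφ^ (suc n) acc) (foldl shiftIn z ys)) (sym (intVal-singleton y)) ⟩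
    addφ (mulφ^ (suc n) acc) (intVal (y ∷ ys))
      ∎
    where
    open ≡-Reasoning
    n = length ys
    intVal-singleton : ∀ d → shiftIn zφ d ≡ digit d
    intVal-singleton true  = refl
    intVal-singleton false = refl

intVal-++ : ∀ xs ys → intVal (xs ++ ys) ≡ addφ (mulφ^ (length ys) (intVal xs)) (intVal ys)
intVal-++ xs ys = trans (Listₚ.foldl-++ shiftIn zφ xs ys) (foldl-shiftIn (intVal xs) ys)

intVal-∷ : ∀ d ys → intVal (d ∷ ys) ≡ addφ (mulφ^ (length ys) (digit d)) (intVal ys)
intVal-∷ true  ys = foldl-shiftIn (digit true) ys
intVal-∷ false ys = foldl-shiftIn (digit false) ys

fracVal-++ : ∀ xs ys → fracVal (xs ++ ys) ≡ addφ (fracVal xs) (divφ^ (length xs) (fracVal ys))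
fracVal-++ []       ys = sym (addφ-identityˡ _)
fracVal-++ (x ∷ xs) ys = begin
  divφ (addφ (digit x) (fracVal (xs ++ ys)))
    ≡⟨ cong (λ z → divφ (addφ (digit x) z)) (fracVal-++ xs ys) ⟩
  divφ (addφ (digit x) (addφ (fracVal xs) (divφ^ (length xs) (fracVal ys))))
    ≡⟨ cong divφ (sym (addφ-assoc (digit x) (fracVal xs) _)) ⟩
  divφ (addφ (addφ (digit x) (fracVal xs)) (divφ^ (length xs) (fracVal ys)))
    ≡⟨ divφ-distrib (addφ (digit x) (fracVal xs)) _ ⟩
  addφ (fracVal (x ∷ xs)) (divφ^ (suc (length xs)) (fracVal ys))
    ∎
  where open ≡-Reasoning

mulφ^-fracVal : ∀ fp → mulφ^ (length fp) (fracVal fp) ≡ intVal fp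
mulφ^-fracVal []      = refl
mulφ^-fracVal (d ∷ r) = begin
  mulφ^ (suc n) (divφ (addφ (digit d) (fracVal r)))    ≡⟨ mulφ^-suc n _ ⟩
  mulφ^ n (mulφ (divφ (addφ (digit d) (fracVal r))))   ≡⟨ cong (mulφ^ n) (mulφ-inverseˡ _) ⟩
  mulφ^ n (addφ (digit d) (fracVal r))                 ≡⟨ mulφ^-distrib n _ _ ⟩
  addφ (mulφ^ n (digit d)) (mulφ^ n (fracVal r))       ≡⟨ cong (addφ (mulφ^ n (digit d))) (mulφ^-fracVal r) ⟩
  addφ (mulφ^ n (digit d)) (intVal r)                  ≡⟨ sym (intVal-∷ d r) ⟩
  intVal (d ∷ r)                                       ∎
  where
  open ≡-Reasoning
  n = length r

mulφ^-value : ∀ ip fp → mulφ^ (length fp) (value ip fp) ≡ intVal (ip ++ fp)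
mulφ^-value ip fp = begin
  mulφ^ (length fp) (value ip fp)                                     ≡⟨ mulφ^-distrib (length fp) _ _ ⟩
  addφ (mulφ^ (length fp) (intVal ip)) (mulφ^ (length fp) (fracVal fp)) ≡⟨ cong (addφ (mulφ^ (length fp) (intVal ip))) (mulφ^-fracVal fp) ⟩
  addφ (mulφ^ (length fp) (intVal ip)) (intVal fp)                     ≡⟨ sym (intVal-++ ip fp) ⟩
  intVal (ip ++ fp)                                                   ∎
  where open ≡-Reasoning

bitℕ : Bool → ℕ
bitℕ true  = 1
bitℕ false = 0

-- The two coordinates of intVal, using φ ^ k = F (k - 1) + F k φ.
fibPredSum : List Bool → ℕ
fibPredSum []       = 0
fibPredSum (d ∷ ds) = bitℕ d * Fpred (length ds) + fibPredSum ds

fibSum : List Bool → ℕ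
fibSum []       = 0
fibSum (d ∷ ds) = bitℕ d * F (length ds) + fibSum ds

mulφ^-ℕ : ∀ k a → mulφ^ k (+ a , + 0) ≡ (+ (a * Fpred k) , + (a * F k))
mulφ^-ℕ zero    a = cong₂ _,_ (cong +_ (sym (ℕₚ.*-identityʳ a))) (cong +_ (sym (ℕₚ.*-zeroʳ a)))
mulφ^-ℕ (suc k) a rewrite mulφ^-ℕ k a =
  cong₂ _,_ refl (cong +_ (trans (sym (ℕₚ.*-distribˡ-+ a (Fpred k) (F k))) (cong (a *_) (sym (F-suc k)))))

mulφ^-oneφ : ∀ k → mulφ^ k oneφ ≡ (+ Fpred k , + F k)
mulφ^-oneφ k = trans (mulφ^-ℕ k 1) (cong₂ _,_ (cong +_ (ℕₚ.*-identityˡ (Fpred k))) (cong +_ (ℕₚ.*-identityˡ (F k))))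

digit≡bitℕ : ∀ d → digit d ≡ (+ bitℕ d , + 0)
digit≡bitℕ true  = refl
digit≡bitℕ false = refl

intVal≡fibSums : ∀ ds → intVal ds ≡ (+ fibPredSum ds , + fibSum ds)
intVal≡fibSums []       = refl
intVal≡fibSums (d ∷ ds)
  rewrite intVal-∷ d ds | intVal≡fibSums ds | digit≡bitℕ d | mulφ^-ℕ (length ds) (bitℕ d) = refl

LastOne : List Bool → Set
LastOne []           = ⊥
LastOne (d ∷ [])     = d ≡ true
LastOne (_ ∷ d ∷ ds) = LastOne (d ∷ ds)

NoAdj11-tail : ∀ d ds → NoAdj11 (d ∷ ds) → NoAdj11 ds
NoAdj11-tail d     []           _ = tt
NoAdj11-tail true  (true ∷ ds)  ()
NoAdj11-tail true  (false ∷ ds) h = h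
NoAdj11-tail false (e ∷ ds)     h = h

NoAdj11-0∷ : ∀ ds → NoAdj11 ds → NoAdj11 (false ∷ ds)
NoAdj11-0∷ []       _ = tt
NoAdj11-0∷ (d ∷ ds) h = h

NoAdj11-10∷ : ∀ ds → NoAdj11 ds → NoAdj11 (true ∷ false ∷ ds)
NoAdj11-10∷ = NoAdj11-0∷

NoAdj11-10∷⁻ : ∀ ds → NoAdj11 (true ∷ false ∷ ds) → NoAdj11 ds
NoAdj11-10∷⁻ ds h = NoAdj11-tail false ds (NoAdj11-tail true (false ∷ ds) h)

NoAdj11-++ : ∀ xs ys → NoAdj11 xs → NoAdj11 ys → (LastOne xs → HeadOne ys → ⊥) → NoAdj11 (xs ++ ys)
NoAdj11-++ []                  ys           _  hy _ = hy
NoAdj11-++ (x ∷ [])            []           _  _  _ = tt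
NoAdj11-++ (true ∷ [])         (true ∷ ys)  _  _  k = ⊥-elim (k refl refl)
NoAdj11-++ (true ∷ [])         (false ∷ ys) _  hy _ = hy
NoAdj11-++ (false ∷ [])        (y ∷ ys)     _  hy _ = hy
NoAdj11-++ (true ∷ true ∷ xs)  ys           ()
NoAdj11-++ (true ∷ false ∷ xs) ys           hx hy k = NoAdj11-++ (false ∷ xs) ys hx hy k
NoAdj11-++ (false ∷ x ∷ xs)    ys           hx hy k = NoAdj11-++ (x ∷ xs) ys hx hy k

NoAdj11-++-0∷ : ∀ xs ys → NoAdj11 xs → NoAdj11 ys → NoAdj11 (xs ++ false ∷ ys)
NoAdj11-++-0∷ xs ys hx hy = NoAdj11-++ xs (false ∷ ys) hx (NoAdj11-0∷ ys hy) (λ _ ())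

NoAdj11-++⁻ˡ : ∀ xs ys → NoAdj11 (xs ++ ys) → NoAdj11 xs
NoAdj11-++⁻ˡ []                  ys _ = tt
NoAdj11-++⁻ˡ (x ∷ [])            ys _ = tt
NoAdj11-++⁻ˡ (true ∷ true ∷ xs)  ys ()
NoAdj11-++⁻ˡ (true ∷ false ∷ xs) ys h = NoAdj11-++⁻ˡ (false ∷ xs) ys h
NoAdj11-++⁻ˡ (false ∷ x ∷ xs)    ys h = NoAdj11-++⁻ˡ (x ∷ xs) ys h

NoAdj11-++⁻ʳ : ∀ xs ys → NoAdj11 (xs ++ ys) → NoAdj11 ys
NoAdj11-++⁻ʳ []       ys h = h
NoAdj11-++⁻ʳ (x ∷ xs) ys h = NoAdj11-++⁻ʳ xs ys (NoAdj11-tail x (xs ++ ys) h)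

LastOne-∷ʳ : ∀ ys y → LastOne (ys ++ y ∷ []) → y ≡ true
LastOne-∷ʳ []           y h = h
LastOne-∷ʳ (_ ∷ [])     y h = h
LastOne-∷ʳ (_ ∷ z ∷ ys) y h = LastOne-∷ʳ (z ∷ ys) y h

LastOne-reverse : ∀ xs → LastOne (reverse xs) → HeadOne xs
LastOne-reverse []       h = h
LastOne-reverse (x ∷ xs) h = LastOne-∷ʳ (reverse xs) x (subst LastOne (Listₚ.unfold-reverse x xs) h)

NoAdj11-reverse : ∀ xs → NoAdj11 xs → NoAdj11 (reverse xs)
NoAdj11-reverse []       _ = tt
NoAdj11-reverse (x ∷ xs) h = subst NoAdj11 (sym (Listₚ.unfold-reverse x xs))
  (NoAdj11-++ (reverse xs) (x ∷ []) (NoAdj11-reverse xs (NoAdj11-tail x xs h)) tt (no11 x xs h))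
  where
  no11 : ∀ x xs → NoAdj11 (x ∷ xs) → LastOne (reverse xs) → HeadOne (x ∷ []) → ⊥
  no11 x     []            _  ()
  no11 true  (true ∷ xs)   ()
  no11 false (y ∷ xs)      _  _ ()
  no11 true  (false ∷ xs)  _  e _ with LastOne-reverse (false ∷ xs) e
  ... | ()

LastOneOrEmpty-∷ʳ : ∀ fp → LastOneOrEmpty fp → fp ≡ [] ⊎ Σ[ fp′ ∈ List Bool ] fp ≡ fp′ ++ true ∷ []
LastOneOrEmpty-∷ʳ []       _    = inj₁ refl
LastOneOrEmpty-∷ʳ (x ∷ []) refl = inj₂ ([] , refl)
LastOneOrEmpty-∷ʳ (x ∷ y ∷ r) h with LastOneOrEmpty-∷ʳ (y ∷ r) h
... | inj₂ (fp′ , eq) = inj₂ (x ∷ fp′ , cong (x ∷_) eq)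

LastOneOrEmpty-++ : ∀ xs y ys → LastOneOrEmpty (y ∷ ys) → LastOneOrEmpty (xs ++ y ∷ ys)
LastOneOrEmpty-++ []           y ys h = h
LastOneOrEmpty-++ (x ∷ [])     y ys h = h
LastOneOrEmpty-++ (x ∷ z ∷ xs) y ys h = LastOneOrEmpty-++ (z ∷ xs) y ys h

-- Zeckendorf bounds

zeckendorfSum : List Bool → ℕ
zeckendorfSum ds = fibPredSum ds + 2 * fibSum ds

zeckendorfSum-∷ : ∀ d ds → zeckendorfSum (d ∷ ds) ≡ bitℕ d * F (suc (suc (length ds))) + zeckendorfSum ds
zeckendorfSum-∷ d ds = begin
  bitℕ d * Fpred n + fibPredSum ds + 2 * (bitℕ d * F n + fibSum ds)
    ≡⟨ ring (bitℕ d) (Fpred n) (F n) (fibPredSum ds) (fibSum ds) ⟩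
  bitℕ d * (Fpred n + 2 * F n) + zeckendorfSum ds
    ≡⟨ cong (λ z → bitℕ d * z + zeckendorfSum ds) (sym (F-suc-suc n)) ⟩
  bitℕ d * F (suc (suc n)) + zeckendorfSum ds
    ∎
  where
  open ≡-Reasoning
  n = length ds
  ring : ∀ d g f a b → d * g + a + 2 * (d * f + b) ≡ d * (g + 2 * f) + (a + 2 * b)
  ring = ℕ-solve

zeckendorfSum< : ∀ ds → NoAdj11 ds → zeckendorfSum ds < F (suc (suc (length ds)))
zeckendorfSum< []                  _ = s≤s z≤n
zeckendorfSum< (false ∷ ds)        h = begin-strict
  zeckendorfSum (false ∷ ds)    ≡⟨ zeckendorfSum-∷ false ds ⟩
  zeckendorfSum ds              <⟨ zeckendorfSum< ds (NoAdj11-tail false ds h) ⟩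
  F (suc (suc (length ds)))     ≤⟨ F-≤-suc (suc (suc (length ds))) ⟩
  F (suc (suc (suc (length ds)))) ∎
  where open ℕₚ.≤-Reasoning
zeckendorfSum< (true ∷ [])         _ = s≤s (s≤s z≤n)
zeckendorfSum< (true ∷ true ∷ ds)  ()
zeckendorfSum< (true ∷ false ∷ ds) h = begin-strict
  zeckendorfSum (true ∷ false ∷ ds)  ≡⟨ zeckendorfSum-∷ true (false ∷ ds) ⟩
  1 * F (suc (suc (suc n))) + zeckendorfSum (false ∷ ds)
    ≡⟨ cong₂ _+_ (ℕₚ.*-identityˡ (F (suc (suc (suc n))))) (zeckendorfSum-∷ false ds) ⟩
  F (suc (suc (suc n))) + (0 * F (suc (suc n)) + zeckendorfSum ds)
    ≡⟨⟩
  F (suc (suc (suc n))) + zeckendorfSum ds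
    <⟨ ℕₚ.+-monoʳ-< (F (suc (suc (suc n)))) (zeckendorfSum< ds (NoAdj11-tail false ds h)) ⟩
  F (suc (suc (suc n))) + F (suc (suc n)) ∎
  where
  open ℕₚ.≤-Reasoning
  n = length ds

F≤zeckendorfSum : ∀ ds → F (suc (suc (length ds))) ≤ zeckendorfSum (true ∷ ds)
F≤zeckendorfSum ds = begin
  F (suc (suc (length ds)))                             ≡⟨ sym (ℕₚ.*-identityˡ _) ⟩
  1 * F (suc (suc (length ds)))                         ≤⟨ ℕₚ.m≤m+n _ (zeckendorfSum ds) ⟩
  1 * F (suc (suc (length ds))) + zeckendorfSum ds      ≡⟨ sym (zeckendorfSum-∷ true ds) ⟩
  zeckendorfSum (true ∷ ds)                             ∎
  where open ℕₚ.≤-Reasoning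

fibSum+%2≤F : ∀ ds → NoAdj11 ds → fibSum ds + length ds % 2 ≤ F (length ds)
fibSum+%2≤F []                  _ = z≤n
fibSum+%2≤F (false ∷ ds)        h = ℕₚ.+-cancelʳ-≤ (n % 2) _ _ (begin
  fibSum ds + suc n % 2 + n % 2  ≡⟨ ring (fibSum ds) (suc n % 2) (n % 2) ⟩
  fibSum ds + n % 2 + suc n % 2  ≤⟨ ℕₚ.+-monoˡ-≤ (suc n % 2) (fibSum+%2≤F ds (NoAdj11-tail false ds h)) ⟩
  F n + suc n % 2                ≤⟨ F+suc%2≤ n ⟩
  F (suc n) + n % 2                ∎)
  where
  open ℕₚ.≤-Reasoning
  n = length ds
  ring : ∀ a b c → a + b + c ≡ a + c + b
  ring = ℕ-solve
  F+suc%2≤ : ∀ k → F k + suc k % 2 ≤ F (suc k) + k % 2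
  F+suc%2≤ zero          = s≤s z≤n
  F+suc%2≤ (suc zero)    = s≤s z≤n
  F+suc%2≤ (suc (suc k)) = begin
    F (suc (suc k)) + suc k % 2             ≤⟨ ℕₚ.+-monoʳ-≤ (F (suc (suc k))) (ℕₚ.≤-trans (%2≤1 (suc k)) (F-suc-positive k)) ⟩
    F (suc (suc k)) + F (suc k)               ≤⟨ ℕₚ.m≤m+n _ (k % 2) ⟩
    F (suc (suc k)) + F (suc k) + k % 2       ∎
fibSum+%2≤F (true ∷ [])         _ = s≤s z≤n
fibSum+%2≤F (true ∷ true ∷ ds)  ()
fibSum+%2≤F (true ∷ false ∷ ds) h = begin
  F (suc n) + 0 + (0 * F n + fibSum ds) + n % 2 ≡⟨ cong (λ z → z + fibSum ds + n % 2) (ℕₚ.+-identityʳ (F (suc n))) ⟩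
  F (suc n) + fibSum ds + n % 2                 ≡⟨ ℕₚ.+-assoc (F (suc n)) (fibSum ds) (n % 2) ⟩
  F (suc n) + (fibSum ds + n % 2)               ≤⟨ ℕₚ.+-monoʳ-≤ (F (suc n)) (fibSum+%2≤F ds (NoAdj11-tail false ds h)) ⟩
  F (suc n) + F n                               ∎
  where
  open ℕₚ.≤-Reasoning
  n = length ds

F≤fibSum : ∀ ds → F (length ds) ≤ fibSum (true ∷ ds)
F≤fibSum ds = ℕₚ.≤-trans (ℕₚ.≤-reflexive (sym (ℕₚ.+-identityʳ _))) (ℕₚ.m≤m+n _ (fibSum ds))

-- Alternating Fibonacci sums

neg^ : ℕ → ℤ → ℤ
neg^ zero    x = x
neg^ (suc k) x = - neg^ k x

neg^-distrib : ∀ k x y → neg^ k (x ℤ.+ y) ≡ neg^ k x ℤ.+ neg^ k y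
neg^-distrib zero    x y = refl
neg^-distrib (suc k) x y = trans (cong -_ (neg^-distrib k x y)) (ℤₚ.neg-distrib-+ (neg^ k x) (neg^ k y))

neg^-dbl : ∀ j x → neg^ (dbl j) x ≡ x
neg^-dbl zero    x = refl
neg^-dbl (suc j) x = trans (ℤₚ.neg-involutive (neg^ (dbl j) x)) (neg^-dbl j x)

signedF : ℕ → ℤ
signedF k = neg^ k (+ F k)

signedF-dbl : ∀ j → signedF (dbl j) ≡ + F (dbl j)
signedF-dbl j = neg^-dbl j (+ F (dbl j))

signedF-suc-dbl : ∀ j → signedF (suc (dbl j)) ≡ - (+ F (suc (dbl j)))
signedF-suc-dbl j = cong -_ (neg^-dbl j (+ F (suc (dbl j))))

divφ^-oneφ : ∀ k → divφ^ k oneφ ≡ (neg^ k (+ F (suc k)) , neg^ (suc k) (+ F k))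
divφ^-oneφ zero    = refl
divφ^-oneφ (suc k) rewrite divφ^-oneφ k =
  cong₂ _,_ (trans (ring (neg^ k (+ F k)) (neg^ k (+ F (suc k))))
                   (cong -_ (sym (neg^-distrib k (+ F (suc k)) (+ F k)))))
            (sym (ℤₚ.neg-involutive (neg^ k (+ F (suc k)))))
  where
  ring : ∀ x y → - x ℤ.- y ≡ - (y ℤ.+ x)
  ring = ℤ-solve

-- Meant for reverse fp: the list starts at the last fractional digit, and a one at φ ^ -i contributes (-1) ^ i F i.
altFibSum : List Bool → ℤ
altFibSum []            = + 0
altFibSum (false ∷ ds)  = altFibSum ds
altFibSum (true ∷ ds)   = signedF (suc (length ds)) ℤ.+ altFibSum ds

fracVal-φ-coordinate : ∀ ds → proj₂ (fracVal (reverse ds)) ≡ - altFibSum ds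
fracVal-φ-coordinate []       = refl
fracVal-φ-coordinate (d ∷ ds) = begin
  proj₂ (fracVal (reverse (d ∷ ds)))
    ≡⟨ cong (λ z → proj₂ (fracVal z)) (Listₚ.unfold-reverse d ds) ⟩
  proj₂ (fracVal (reverse ds ++ d ∷ []))
    ≡⟨ cong proj₂ (fracVal-++ (reverse ds) (d ∷ [])) ⟩
  proj₂ (fracVal (reverse ds)) ℤ.+ proj₂ (divφ^ (length (reverse ds)) (fracVal (d ∷ [])))
    ≡⟨ cong₂ ℤ._+_ (fracVal-φ-coordinate ds) (cong (λ n → proj₂ (divφ^ n (fracVal (d ∷ [])))) (Listₚ.length-reverse ds)) ⟩
  - altFibSum ds ℤ.+ proj₂ (divφ^ (length ds) (fracVal (d ∷ [])))
    ≡⟨ lastDigit d ⟩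
  - altFibSum (d ∷ ds)
    ∎
  where
  open ≡-Reasoning
  n = length ds
  ring : ∀ s t → - t ℤ.+ - - s ≡ - (- s ℤ.+ t)
  ring = ℤ-solve
  lastDigit : ∀ d → - altFibSum ds ℤ.+ proj₂ (divφ^ n (fracVal (d ∷ []))) ≡ - altFibSum (d ∷ ds)
  lastDigit false = trans (cong (λ z → - altFibSum ds ℤ.+ proj₂ z) (divφ^-zφ n)) (ℤₚ.+-identityʳ _)
  lastDigit true  = begin
    - altFibSum ds ℤ.+ proj₂ (divφ^ n (divφ oneφ))  ≡⟨ cong (λ z → - altFibSum ds ℤ.+ proj₂ z) (sym (divφ^-suc n oneφ)) ⟩
    - altFibSum ds ℤ.+ proj₂ (divφ^ (suc n) oneφ)   ≡⟨ cong (λ z → - altFibSum ds ℤ.+ proj₂ z) (divφ^-oneφ (suc n)) ⟩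
    - altFibSum ds ℤ.+ - - neg^ n (+ F (suc n))       ≡⟨ ring (neg^ n (+ F (suc n))) (altFibSum ds) ⟩
    - altFibSum (true ∷ ds)                         ∎

altFibSum-10∷-even : ∀ j ds → length ds ≡ dbl j →
                     altFibSum (true ∷ false ∷ ds) ≡ + F (suc (suc (dbl j))) ℤ.+ altFibSum ds
altFibSum-10∷-even j ds e = cong (ℤ._+ altFibSum ds) (trans (cong (λ n → signedF (suc (suc n))) e) (signedF-dbl (suc j)))

altFibSum-10∷-odd : ∀ j ds → length ds ≡ suc (dbl j) →
                    altFibSum (true ∷ false ∷ ds) ≡ - (+ F (suc (suc (suc (dbl j))))) ℤ.+ altFibSum ds
altFibSum-10∷-odd j ds e = cong (ℤ._+ altFibSum ds) (trans (cong (λ n → signedF (suc (suc n))) e) (signedF-suc-dbl (suc j)))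

private
  +F-mono-≤ : ∀ {a b} → a ≤ b → + F a ℤ.≤ + F b
  +F-mono-≤ a≤b = +≤+ (F-mono-≤ a≤b)

  n≤2+n : ∀ n → n ≤ suc (suc n)
  n≤2+n n = ℕₚ.≤-trans (ℕₚ.n≤1+n n) (ℕₚ.n≤1+n (suc n))

mutual
  altFibSum-even-bounds : ∀ j ds → NoAdj11 ds → length ds ≡ dbl j →
    - (+ F (dbl j)) ℤ.≤ altFibSum ds × altFibSum ds ℤ.< + F (suc (dbl j))
  altFibSum-even-bounds zero [] _ _ = ℤₚ.≤-refl , +<+ (s≤s z≤n)
  altFibSum-even-bounds (suc j) (false ∷ ds) h e
    with altFibSum-odd-bounds j ds (NoAdj11-tail false ds h) (ℕₚ.suc-injective e)
  ... | lo , up = lo , ℤₚ.<-≤-trans up (+F-mono-≤ (n≤2+n (suc (dbl j))))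
  altFibSum-even-bounds (suc j) (true ∷ true ∷ ds) ()
  altFibSum-even-bounds (suc j) (true ∷ false ∷ ds) h e
    with altFibSum-10∷-even-bounds j ds h (ℕₚ.suc-injective (ℕₚ.suc-injective e))
  ... | lo , up = ℤₚ.≤-trans ℤₚ.neg-≤-pos (ℤₚ.≤-trans (+≤+ z≤n) lo) , up

  altFibSum-odd-bounds : ∀ j ds → NoAdj11 ds → length ds ≡ suc (dbl j) →
    - (+ F (suc (suc (dbl j)))) ℤ.≤ altFibSum ds × altFibSum ds ℤ.< + F (suc (dbl j))
  altFibSum-odd-bounds j (false ∷ ds) h e
    with altFibSum-even-bounds j ds (NoAdj11-tail false ds h) (ℕₚ.suc-injective e)
  ... | lo , up = ℤₚ.≤-trans (ℤₚ.neg-mono-≤ (+F-mono-≤ (n≤2+n (dbl j)))) lo , up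
  altFibSum-odd-bounds zero (true ∷ []) _ _ = ℤₚ.≤-refl , ℤ.-<+
  altFibSum-odd-bounds (suc j) (true ∷ true ∷ ds) ()
  altFibSum-odd-bounds (suc j) (true ∷ false ∷ ds) h e
    with altFibSum-odd-bounds j ds (NoAdj11-tail false ds h) (ℕₚ.suc-injective (ℕₚ.suc-injective e))
  ... | lo , _ = lo′ , ℤₚ.<-≤-trans (altFibSum-10∷-odd-negative j ds h |ds|) (+≤+ z≤n)
    where
    |ds| = ℕₚ.suc-injective (ℕₚ.suc-injective e)
    a = + F (suc (suc (suc (dbl j))))
    b = + F (suc (suc (dbl j)))
    open ℤₚ.≤-Reasoning
    lo′ : - (+ F (suc (suc (suc (suc (dbl j)))))) ℤ.≤ altFibSum (true ∷ false ∷ ds)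
    lo′ = begin
      - (a ℤ.+ b)                   ≡⟨ ℤₚ.neg-distrib-+ a b ⟩
      - a ℤ.+ - b                   ≤⟨ ℤₚ.+-monoʳ-≤ (- a) lo ⟩
      - a ℤ.+ altFibSum ds          ≡⟨ sym (altFibSum-10∷-odd j ds |ds|) ⟩
      altFibSum (true ∷ false ∷ ds) ∎

  altFibSum-10∷-even-bounds : ∀ j ds → NoAdj11 (true ∷ false ∷ ds) → length ds ≡ dbl j →
    + F (suc (dbl j)) ℤ.≤ altFibSum (true ∷ false ∷ ds) ×
    altFibSum (true ∷ false ∷ ds) ℤ.< + F (suc (suc (suc (dbl j))))
  altFibSum-10∷-even-bounds j ds h e with altFibSum-even-bounds j ds (NoAdj11-tail false ds h) e
  ... | lo , up = lo′ , up′
    where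
    a = + F (suc (dbl j))
    b = + F (dbl j)
    open ℤₚ.≤-Reasoning
    ring : ∀ a b → a ≡ (a ℤ.+ b) ℤ.+ - b
    ring = ℤ-solve
    lo′ : + F (suc (dbl j)) ℤ.≤ altFibSum (true ∷ false ∷ ds)
    lo′ = begin
      a                              ≡⟨ ring a b ⟩
      (a ℤ.+ b) ℤ.+ - b              ≤⟨ ℤₚ.+-monoʳ-≤ (a ℤ.+ b) lo ⟩
      (a ℤ.+ b) ℤ.+ altFibSum ds     ≡⟨ sym (altFibSum-10∷-even j ds e) ⟩
      altFibSum (true ∷ false ∷ ds)  ∎
    up′ : altFibSum (true ∷ false ∷ ds) ℤ.< + F (suc (suc (suc (dbl j))))
    up′ = begin-strict
      altFibSum (true ∷ false ∷ ds)                 ≡⟨ altFibSum-10∷-even j ds e ⟩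
      + F (suc (suc (dbl j))) ℤ.+ altFibSum ds      <⟨ ℤₚ.+-monoʳ-< (+ F (suc (suc (dbl j)))) up ⟩
      + F (suc (suc (dbl j))) ℤ.+ + F (suc (dbl j)) ∎

  altFibSum-10∷-odd-negative : ∀ j ds → NoAdj11 (true ∷ false ∷ ds) → length ds ≡ suc (dbl j) →
    altFibSum (true ∷ false ∷ ds) ℤ.< + 0
  altFibSum-10∷-odd-negative j ds h e with altFibSum-odd-bounds j ds (NoAdj11-tail false ds h) e
  ... | _ , up = begin-strict
    altFibSum (true ∷ false ∷ ds)    ≡⟨ altFibSum-10∷-odd j ds e ⟩
    - a ℤ.+ altFibSum ds             <⟨ ℤₚ.+-monoʳ-< (- a) up ⟩
    - a ℤ.+ + F (suc (dbl j))        ≤⟨ ℤₚ.+-monoʳ-≤ (- a) (+F-mono-≤ (n≤2+n (suc (dbl j)))) ⟩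
    - a ℤ.+ a                        ≡⟨ ℤₚ.+-inverseˡ a ⟩
    + 0                              ∎
    where
    a = + F (suc (suc (suc (dbl j))))
    open ℤₚ.≤-Reasoning

altFibSum-1∷-odd-negative : ∀ j ds → NoAdj11 (true ∷ ds) → length (true ∷ ds) ≡ suc (dbl j) →
                            altFibSum (true ∷ ds) ℤ.< + 0
altFibSum-1∷-odd-negative zero    []           _ _ = ℤ.-<+
altFibSum-1∷-odd-negative (suc j) (true ∷ ds)  () _
altFibSum-1∷-odd-negative (suc j) (false ∷ ds) h  e =
  altFibSum-10∷-odd-negative j ds h (ℕₚ.suc-injective (ℕₚ.suc-injective e))

F<altFibSum-1010∷ : ∀ k ds → NoAdj11 ds → length ds ≡ dbl k →
                    + F (suc (suc (dbl (suc k)))) ℤ.< altFibSum (true ∷ false ∷ true ∷ false ∷ ds)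
F<altFibSum-1010∷ k ds h e = begin-strict
  a                                            ≡⟨ sym (ℤₚ.+-identityʳ a) ⟩
  a ℤ.+ + 0                                    <⟨ ℤₚ.+-monoʳ-< a (ℤₚ.<-≤-trans (+<+ (F-suc-positive (dbl k))) lo) ⟩
  a ℤ.+ altFibSum (true ∷ false ∷ ds)          ≡⟨ sym (altFibSum-10∷-even (suc k) (true ∷ false ∷ ds) (cong (λ n → suc (suc n)) e)) ⟩
  altFibSum (true ∷ false ∷ true ∷ false ∷ ds) ∎
  where
  open ℤₚ.≤-Reasoning
  a = + F (suc (suc (dbl (suc k))))
  lo = proj₁ (altFibSum-10∷-even-bounds k ds (NoAdj11-10∷ ds h) e)

_∈[_,_⟩ : ℕ → ℕ → ℕ → Set
N ∈[ a , b ⟩ = a ≤ N × N < b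

-- Λ k = [Λmin k, Λmin (k + 1)): the odd intervals start one past a Lucas number.
Λmin : ℕ → ℕ
Λmin k = L k + k % 2

Λmin-dbl : ∀ j → Λmin (dbl j) ≡ L (dbl j)
Λmin-dbl j = trans (cong (_+_ (L (dbl j))) (dbl%2 j)) (ℕₚ.+-identityʳ _)

Λmin-suc-dbl : ∀ j → Λmin (suc (dbl j)) ≡ suc (L (suc (dbl j)))
Λmin-suc-dbl j = trans (cong (_+_ (L (suc (dbl j)))) (suc-dbl%2 j)) (ℕₚ.+-comm _ 1)

Λ-dbl : ∀ j N → Λ (dbl j) N ≡ (L (dbl j) ≤ N × N ≤ L (suc (dbl j)))
Λ-dbl j N rewrite dbl%2 j | dbl/2 j | 2*≡dbl j = refl

Λ-suc-dbl : ∀ j N → Λ (suc (dbl j)) N ≡ (suc (L (suc (dbl j))) ≤ N × suc N ≤ L (suc (suc (dbl j))))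
Λ-suc-dbl j N rewrite suc-dbl%2 j | suc-dbl/2 j | 2*≡dbl j = refl

Λ⇔∈[⟩ : ∀ k N {u v} → Λmin k ≡ u → Λmin (suc k) ≡ v → Λ k N ⇔ N ∈[ u , v ⟩
Λ⇔∈[⟩ k N refl refl with parity k
... | j , inj₁ refl rewrite Λ-dbl j N | Λmin-dbl j | Λmin-suc-dbl j =
  mk⇔ (λ (a , b) → a , s≤s b) (λ (a , b) → a , ℕₚ.≤-pred b)
... | j , inj₂ refl rewrite Λ-suc-dbl j N | Λmin-suc-dbl j | Λmin-dbl (suc j) =
  mk⇔ (λ h → h) (λ h → h)

Λmin-≤-suc : ∀ k → Λmin k ≤ Λmin (suc k)
Λmin-≤-suc zero    = s≤s (s≤s z≤n)
Λmin-≤-suc (suc k) = ℕₚ.≤-trans (ℕₚ.+-monoʳ-≤ (L (suc k)) (ℕₚ.≤-trans (%2≤1 (suc k)) (L-positive k)))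
                                 (ℕₚ.m≤m+n (L (suc k) + L k) (k % 2))

Λmin-mono-≤ : ∀ {a b} → a ≤ b → Λmin a ≤ Λmin b
Λmin-mono-≤ a≤b = go (ℕₚ.≤⇒≤′ a≤b)
  where
  go : ∀ {a b} → a ≤′ b → Λmin a ≤ Λmin b
  go ≤′-refl             = ℕₚ.≤-refl
  go (≤′-step {n} a≤b) = ℕₚ.≤-trans (go a≤b) (Λmin-≤-suc n)

2≤Λmin-suc : ∀ k → 2 ≤ Λmin (suc k)
2≤Λmin-suc zero    = s≤s (s≤s z≤n)
2≤Λmin-suc (suc k) = ℕₚ.≤-trans (ℕₚ.+-mono-≤ (L-positive (suc k)) (L-positive k)) (ℕₚ.m≤m+n _ (suc (suc k) % 2))

Λ-unique : ∀ {a b N} → Λ a N → Λ b N → a ≡ b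
Λ-unique {a} {b} {N} ha hb with Equivalence.to (Λ⇔∈[⟩ a N refl refl) ha | Equivalence.to (Λ⇔∈[⟩ b N refl refl) hb | ℕₚ.<-cmp a b
... | _ , a₂ | b₁ , _ | tri< a<b _ _ = ⊥-elim (ℕₚ.<⇒≱ a₂ (ℕₚ.≤-trans (Λmin-mono-≤ a<b) b₁))
... | _      | _      | tri≈ _ a≡b _ = a≡b
... | a₁ , _ | _ , b₂ | tri> _ _ b<a = ⊥-elim (ℕₚ.<⇒≱ b₂ (ℕₚ.≤-trans (Λmin-mono-≤ b<a) a₁))

∈Λ+⇔∈[⟩ : ∀ k x X {u v} → Λmin k + x ≡ u → Λmin (suc k) + x ≡ v → X ∈Λ k + x ⇔ X ∈[ u , v ⟩
∈Λ+⇔∈[⟩ k x X refl refl = mk⇔ to from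
  where
  to : X ∈Λ k + x → X ∈[ Λmin k + x , Λmin (suc k) + x ⟩
  to (x≤X , h) with Equivalence.to (Λ⇔∈[⟩ k (X ∸ x) refl refl) h
  ... | a , b = subst (Λmin k + x ≤_) e (ℕₚ.+-monoˡ-≤ x a) , subst (_< Λmin (suc k) + x) e (ℕₚ.+-monoˡ-< x b)
    where
    e : X ∸ x + x ≡ X
    e = ℕₚ.m∸n+n≡m x≤X
  from : X ∈[ Λmin k + x , Λmin (suc k) + x ⟩ → X ∈Λ k + x
  from (a , b) = x≤X , Equivalence.from (Λ⇔∈[⟩ k (X ∸ x) refl refl) (a′ , b′)
    where
    x≤X : x ≤ X
    x≤X = ℕₚ.≤-trans (ℕₚ.m≤n+m x (Λmin k)) a
    e : X ∸ x + x ≡ X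
    e = ℕₚ.m∸n+n≡m x≤X
    a′ : Λmin k ≤ X ∸ x
    a′ = ℕₚ.+-cancelʳ-≤ x _ _ (subst (Λmin k + x ≤_) (sym e) a)
    b′ : X ∸ x < Λmin (suc k)
    b′ = ℕₚ.+-cancelʳ-≤ x _ _ (subst (λ z → suc z ≤ Λmin (suc k) + x) (sym e) b)

∈[⟩-split₃ : ∀ {a b c d} → a ≤ b → b ≤ c → c ≤ d →
             ∀ N → N ∈[ a , d ⟩ ⇔ (N ∈[ a , b ⟩ ⊎ N ∈[ b , c ⟩ ⊎ N ∈[ c , d ⟩)
∈[⟩-split₃ {a} {b} {c} {d} a≤b b≤c c≤d N = mk⇔ to from
  where
  to : N ∈[ a , d ⟩ → N ∈[ a , b ⟩ ⊎ N ∈[ b , c ⟩ ⊎ N ∈[ c , d ⟩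
  to (a≤N , N<d) with ℕₚ.<-≤-connex N b | ℕₚ.<-≤-connex N c
  ... | inj₁ N<b | _        = inj₁ (a≤N , N<b)
  ... | inj₂ b≤N | inj₁ N<c = inj₂ (inj₁ (b≤N , N<c))
  ... | inj₂ _   | inj₂ c≤N = inj₂ (inj₂ (c≤N , N<d))
  from : N ∈[ a , b ⟩ ⊎ N ∈[ b , c ⟩ ⊎ N ∈[ c , d ⟩ → N ∈[ a , d ⟩
  from (inj₁ (a≤N , N<b))        = a≤N , ℕₚ.<-≤-trans N<b (ℕₚ.≤-trans b≤c c≤d)
  from (inj₂ (inj₁ (b≤N , N<c))) = ℕₚ.≤-trans a≤b b≤N , ℕₚ.<-≤-trans N<c c≤d
  from (inj₂ (inj₂ (c≤N , N<d))) = ℕₚ.≤-trans (ℕₚ.≤-trans a≤b b≤c) c≤N , N<d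

-- The shape of an expansion determines its Lucas interval

altFibSum-reverse≡fibSum : ∀ ip fp {M} → value ip fp ≡ (+ M , + 0) → altFibSum (reverse fp) ≡ + fibSum ip
altFibSum-reverse≡fibSum ip fp val = sym (ℤₚ.i-j≡0⇒i≡j (+ fibSum ip) (altFibSum (reverse fp)) (begin
  + fibSum ip ℤ.+ - altFibSum (reverse fp)
    ≡⟨ cong₂ ℤ._+_ (sym (cong proj₂ (intVal≡fibSums ip))) (sym (fracVal-φ-coordinate (reverse fp))) ⟩
  proj₂ (intVal ip) ℤ.+ proj₂ (fracVal (reverse (reverse fp)))
    ≡⟨ cong (λ z → proj₂ (intVal ip) ℤ.+ proj₂ (fracVal z)) (Listₚ.reverse-involutive fp) ⟩
  proj₂ (value ip fp)
    ≡⟨ cong proj₂ val ⟩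
  + 0 ∎))
  where open ≡-Reasoning

zeckendorfSum≡ : ∀ ip fp {M} → value ip fp ≡ (+ M , + 0) → zeckendorfSum (ip ++ fp) ≡ M * F (suc (suc (length fp)))
zeckendorfSum≡ ip fp {M} val = begin
  fibPredSum (ip ++ fp) + 2 * fibSum (ip ++ fp)
    ≡⟨ cong₂ (λ a b → a + 2 * b) (ℤₚ.+-injective (cong proj₁ scaled)) (ℤₚ.+-injective (cong proj₂ scaled)) ⟩
  M * Fpred s + 2 * (M * F s)                    ≡⟨ ring M (Fpred s) (F s) ⟩
  M * (Fpred s + 2 * F s)                        ≡⟨ cong (M *_) (sym (F-suc-suc s)) ⟩
  M * F (suc (suc s))                            ∎
  where
  open ≡-Reasoning
  s = length fp
  scaled : (+ fibPredSum (ip ++ fp) , + fibSum (ip ++ fp)) ≡ (+ (M * Fpred s) , + (M * F s))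
  scaled = trans (sym (intVal≡fibSums (ip ++ fp))) (trans (sym (mulφ^-value ip fp)) (trans (cong (mulφ^ s) val) (mulφ^-ℕ s M)))
  ring : ∀ n g f → n * g + 2 * (n * f) ≡ n * (g + 2 * f)
  ring = ℕ-solve

Λ-dbl-suc-from-F-bounds : ∀ j M → F (suc (suc (dbl (suc j) + dbl (suc j)))) ≤ M * F (suc (suc (dbl (suc j)))) →
  M * F (suc (suc (dbl (suc j)))) < F (suc (suc (suc (dbl (suc j) + dbl (suc j))))) → Λ (dbl (suc j)) M
Λ-dbl-suc-from-F-bounds j M lo hi = subst (λ P → P) (sym (Λ-dbl (suc j) M)) (ℕₚ.≤-pred La<1+M , ℕₚ.≤-pred M<1+La′)
  where
  a = dbl (suc j)
  X = F (suc (suc a))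
  ring₁ : ∀ a → a + 2 ≡ suc (suc a)
  ring₁ = ℕ-solve
  ring₂ : ∀ a → a + (a + 2) ≡ suc (suc (a + a))
  ring₂ = ℕ-solve
  ring₃ : ∀ a → suc a + 1 ≡ suc (suc a)
  ring₃ = ℕ-solve
  ring₄ : ∀ a → suc a + (suc a + 1) ≡ suc (suc (suc (a + a)))
  ring₄ = ℕ-solve
  La*X : L a * X ≡ F (suc (suc (a + a))) + 1
  La*X = subst₂ (λ u v → L a * F u ≡ F v + 1) (ring₁ a) (ring₂ a) (L-even-*-F (suc j) 2)
  La′*X : L (suc a) * X + 1 ≡ F (suc (suc (suc (a + a))))
  La′*X = subst₂ (λ u v → L (suc a) * F u + 1 ≡ F v) (ring₃ a) (ring₄ a) (L-odd-*-F (suc j) 1)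
  2≤X : 2 ≤ X
  2≤X = F-mono-≤ {3} {suc (suc a)} (s≤s (s≤s (s≤s z≤n)))
  open ℕₚ.≤-Reasoning
  La<1+M : L a < suc M
  La<1+M = ℕₚ.*-cancelʳ-< X (L a) (suc M) (begin-strict
    L a * X                   ≡⟨ La*X ⟩
    F (suc (suc (a + a))) + 1 ≤⟨ ℕₚ.+-monoˡ-≤ 1 lo ⟩
    M * X + 1                 <⟨ ℕₚ.+-monoʳ-< (M * X) 2≤X ⟩
    M * X + X                 ≡⟨ ℕₚ.+-comm (M * X) X ⟩
    suc M * X                 ∎)
  M<1+La′ : M < suc (L (suc a))
  M<1+La′ = ℕₚ.*-cancelʳ-< X M (suc (L (suc a))) (begin-strict
    M * X                     <⟨ hi ⟩
    F (suc (suc (suc (a + a)))) ≡⟨ sym La′*X ⟩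
    L (suc a) * X + 1         ≤⟨ ℕₚ.+-monoʳ-≤ (L (suc a) * X) (ℕₚ.≤-trans (s≤s z≤n) 2≤X) ⟩
    L (suc a) * X + X         ≡⟨ ℕₚ.+-comm (L (suc a) * X) X ⟩
    suc (L (suc a)) * X       ∎)

Λ-suc-dbl-from-F-bounds : ∀ j M → F (suc (suc (suc (dbl j) + suc (suc (dbl j))))) ≤ M * F (suc (suc (suc (suc (dbl j))))) →
  M * F (suc (suc (suc (suc (dbl j))))) < F (suc (suc (suc (suc (dbl j) + suc (suc (dbl j)))))) → Λ (suc (dbl j)) M
Λ-suc-dbl-from-F-bounds j M lo hi = subst (λ P → P) (sym (Λ-suc-dbl j M)) (Lb<M , M<Lb′)
  where
  b = suc (dbl j)
  X = F (suc (suc (suc b)))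
  ring₁ : ∀ b → b + 3 ≡ suc (suc (suc b))
  ring₁ = ℕ-solve
  ring₂ : ∀ b → b + (b + 3) ≡ suc (suc (b + suc b))
  ring₂ = ℕ-solve
  ring₃ : ∀ b → suc b + 2 ≡ suc (suc (suc b))
  ring₃ = ℕ-solve
  ring₄ : ∀ b → suc b + (suc b + 2) ≡ suc (suc (suc (b + suc b)))
  ring₄ = ℕ-solve
  Lb*X : L b * X + 2 ≡ F (suc (suc (b + suc b)))
  Lb*X = subst₂ (λ u v → L b * F u + 2 ≡ F v) (ring₁ b) (ring₂ b) (L-odd-*-F j 3)
  Lb′*X : L (suc b) * X ≡ F (suc (suc (suc (b + suc b)))) + 1
  Lb′*X = subst₂ (λ u v → L (suc b) * F u ≡ F v + 1) (ring₃ b) (ring₄ b) (L-even-*-F (suc j) 2)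
  open ℕₚ.≤-Reasoning
  Lb<M : L b < M
  Lb<M = ℕₚ.*-cancelʳ-< X (L b) M (begin-strict
    L b * X                      <⟨ ℕₚ.m<m+n (L b * X) (s≤s z≤n) ⟩
    L b * X + 2                  ≡⟨ Lb*X ⟩
    F (suc (suc (b + suc b)))    ≤⟨ lo ⟩
    M * X                        ∎)
  M<Lb′ : M < L (suc b)
  M<Lb′ = ℕₚ.*-cancelʳ-< X M (L (suc b)) (begin-strict
    M * X                            <⟨ hi ⟩
    F (suc (suc (suc (b + suc b))))  <⟨ ℕₚ.m<m+n _ (s≤s z≤n) ⟩
    F (suc (suc (suc (b + suc b)))) + 1 ≡⟨ sym Lb′*X ⟩
    L (suc b) * X                    ∎)

private
  fibSum+%2≤F-1∷ : ∀ ip0 {t} → NoAdj11 (true ∷ ip0) → length ip0 ≡ t →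
                    fibSum (true ∷ ip0) + suc t % 2 ≤ F (suc t)
  fibSum+%2≤F-1∷ ip0 h refl = fibSum+%2≤F (true ∷ ip0) h

fibSum-bounds-even : ∀ j ip0 → NoAdj11 (true ∷ ip0) → length ip0 ≡ dbl j →
                     F (dbl j) ≤ fibSum (true ∷ ip0) × fibSum (true ∷ ip0) < F (suc (dbl j))
fibSum-bounds-even j ip0 h e =
  subst (λ n → F n ≤ fibSum (true ∷ ip0)) e (F≤fibSum ip0) ,
  subst (_≤ F (suc (dbl j))) (trans (cong (_+_ (fibSum (true ∷ ip0))) (suc-dbl%2 j)) (ℕₚ.+-comm _ 1))
        (fibSum+%2≤F-1∷ ip0 h e)

fibSum-bounds-odd : ∀ j ip0 → NoAdj11 (true ∷ ip0) → length ip0 ≡ suc (dbl j) →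
                    F (suc (dbl j)) ≤ fibSum (true ∷ ip0) × fibSum (true ∷ ip0) ≤ F (suc (suc (dbl j)))
fibSum-bounds-odd j ip0 h e =
  subst (λ n → F n ≤ fibSum (true ∷ ip0)) e (F≤fibSum ip0) ,
  subst (_≤ F (suc (suc (dbl j)))) (trans (cong (_+_ (fibSum (true ∷ ip0))) (dbl%2 j)) (ℕₚ.+-identityʳ _))
        (fibSum+%2≤F-1∷ ip0 h e)

record FractionalShape (fp : List Bool) (P : ℕ) : Set where
  field
    j          : ℕ
    r          : List Bool
    reverse-fp : reverse fp ≡ true ∷ false ∷ r
    length-r   : length r ≡ dbl j
    noAdj11    : NoAdj11 (true ∷ false ∷ r)
    altFibSum≡ : altFibSum (true ∷ false ∷ r) ≡ + P

-- A negative alternating sum would contradict altFibSum (reverse fp) ≡ fibSum ip ≥ 0.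
fractionalShape : ∀ ip0 fp {M} → LastOneOrEmpty fp → NoAdj11 ((true ∷ ip0) ++ fp) →
                  value (true ∷ ip0) fp ≡ (+ M , + 0) → 2 ≤ M → FractionalShape fp (fibSum (true ∷ ip0))
fractionalShape ip0 fp lo na val 2≤M with LastOneOrEmpty-∷ʳ fp lo
... | inj₁ refl = ⊥-elim (emptyFraction ip0 val 2≤M (sym (ℤₚ.+-injective (altFibSum-reverse≡fibSum (true ∷ ip0) [] val))))
  where
  emptyFraction : ∀ ip0 {M} → value (true ∷ ip0) [] ≡ (+ M , + 0) → 2 ≤ M → fibSum (true ∷ ip0) ≡ 0 → ⊥
  emptyFraction []       val 2≤M _ with ℤₚ.+-injective (cong proj₁ val)
  ... | refl = ℕₚ.<⇒≱ 2≤M ℕₚ.≤-refl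
  emptyFraction (d ∷ ds) _ _ P≡0 = ℕₚ.<⇒≱ (F-suc-positive (length ds)) (subst (F (length (d ∷ ds)) ≤_) P≡0 (F≤fibSum (d ∷ ds)))
... | inj₂ (fp′ , refl) = go (reverse fp′) rev≡ noAdj11 sum≡
  where
  P = fibSum (true ∷ ip0)
  rev≡ : reverse (fp′ ++ true ∷ []) ≡ true ∷ reverse fp′
  rev≡ = Listₚ.reverse-++ fp′ (true ∷ [])
  noAdj11 : NoAdj11 (true ∷ reverse fp′)
  noAdj11 = subst NoAdj11 rev≡ (NoAdj11-reverse (fp′ ++ true ∷ []) (NoAdj11-++⁻ʳ (true ∷ ip0) _ na))
  sum≡ : altFibSum (true ∷ reverse fp′) ≡ + P
  sum≡ = subst (λ ds → altFibSum ds ≡ + P) rev≡ (altFibSum-reverse≡fibSum (true ∷ ip0) (fp′ ++ true ∷ []) val)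
  nonNegative : ∀ ds → altFibSum ds ≡ + P → altFibSum ds ℤ.< + 0 → ⊥
  nonNegative _ eq sum<0 = ℕₚ.n≮0 (ℤₚ.drop‿+<+ (subst (ℤ._< + 0) eq sum<0))
  go : ∀ rv → reverse (fp′ ++ true ∷ []) ≡ true ∷ rv → NoAdj11 (true ∷ rv) → altFibSum (true ∷ rv) ≡ + P →
       FractionalShape (fp′ ++ true ∷ []) P
  go []           _    _  eq = ⊥-elim (nonNegative (true ∷ []) eq (altFibSum-1∷-odd-negative 0 [] tt refl))
  go (true ∷ r)   _    () _
  go (false ∷ r)  rev h  eq with parity (length r)
  ... | j , inj₂ |r| = ⊥-elim (nonNegative (true ∷ false ∷ r) eq (altFibSum-10∷-odd-negative j r h |r|))
  ... | j , inj₁ |r| = record { j = j ; r = r ; reverse-fp = rev ; length-r = |r| ; noAdj11 = h ; altFibSum≡ = eq }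

even-index : ∀ j j′ {P} → F (suc (dbl j′)) ≤ P × P < F (suc (suc (suc (dbl j′)))) →
             F (dbl j) ≤ P × P < F (suc (dbl j)) → j ≡ suc j′
even-index j j′ (lo′ , hi′) (lo , hi) = ℕₚ.≤-antisym
  (dbl-cancel-≤ (ℕₚ.≤-pred (F-cancel-< (ℕₚ.≤-<-trans lo hi′))))
  (dbl≤suc-dbl⇒≤ (F-cancel-< (ℕₚ.≤-<-trans lo′ hi)))

odd-index : ∀ j j′ {P} → F (suc (dbl j′)) ≤ P × P < F (suc (suc (suc (dbl j′)))) →
            F (suc (dbl j)) ≤ P × P ≤ F (suc (suc (dbl j))) → j ≡ j′
odd-index j j′ (lo′ , hi′) (lo , hi) = ℕₚ.≤-antisym
  (dbl≤suc-dbl⇒≤ (ℕₚ.≤-pred (ℕₚ.≤-pred (F-cancel-< (ℕₚ.≤-<-trans lo hi′)))))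
  (ℕₚ.≮⇒≥ j<j′-impossible)
  where
  -- If j < j′ then F (2j′+1) ≤ P ≤ F (2j+2) < F (2j+3) ≤ F (2j′+1).
  j<j′-impossible : ¬ (j < j′)
  j<j′-impossible j<j′ = ℕₚ.<⇒≱ F2j+2<F2j+3 (ℕₚ.≤-trans (F-mono-≤ (s≤s (dbl-mono-≤ j<j′))) (ℕₚ.≤-trans lo′ hi))
    where
    F2j+2<F2j+3 : F (suc (suc (dbl j))) < F (suc (suc (suc (dbl j))))
    F2j+2<F2j+3 = subst (F (suc (suc (dbl j))) <_) (ℕₚ.+-comm (F (suc (dbl j))) (F (suc (suc (dbl j)))))
                        (ℕₚ.m<n+m (F (suc (suc (dbl j)))) (F-suc-positive (dbl j)))

-- Reading 1010 at the end of the fraction would make the alternating sum too large.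
fraction-ends-001 : ∀ j r {P} → NoAdj11 (true ∷ false ∷ r) → length r ≡ dbl j →
                    altFibSum (true ∷ false ∷ r) ≡ + P → P ≤ F (suc (suc (dbl j))) →
                    j ≡ 0 ⊎ Σ[ r′ ∈ List Bool ] r ≡ false ∷ r′
fraction-ends-001 zero    r                    _ _  _  _ = inj₁ refl
fraction-ends-001 (suc k) (false ∷ r′)         _ _  _  _ = inj₂ (r′ , refl)
fraction-ends-001 (suc k) (true ∷ true ∷ r′)   () _ _  _
fraction-ends-001 (suc k) (true ∷ false ∷ r′)  h  |r| eq P≤ =
  ⊥-elim (ℤₚ.<⇒≱ (F<altFibSum-1010∷ k r′ (NoAdj11-tail false r′ h) (ℕₚ.suc-injective (ℕₚ.suc-injective |r|)))
                 (subst (ℤ._≤ + F (suc (suc (dbl (suc k))))) (sym eq) (+≤+ P≤)))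

data EvenShape (m : ℕ) : List Bool → List Bool → Set where
  even-shape : ∀ ip′ fp′ → length ip′ ≡ suc (dbl m) → length fp′ ≡ dbl m →
               EvenShape m (true ∷ false ∷ ip′) (fp′ ++ false ∷ true ∷ [])

data OddShape (m : ℕ) : List Bool → List Bool → Set where
  odd-shape : ∀ ip′ fp′ → length ip′ ≡ dbl m → length fp′ ≡ dbl m →
              (m ≡ 0 ⊎ Σ[ fp″ ∈ List Bool ] fp′ ≡ fp″ ++ false ∷ []) →
              OddShape m (true ∷ false ∷ ip′) (fp′ ++ false ∷ true ∷ [])

Shape : ℕ → List Bool → List Bool → Set
Shape M ip fp = (Σ[ m ∈ ℕ ] Λ (dbl (suc m)) M × EvenShape m ip fp) ⊎
                (Σ[ m ∈ ℕ ] Λ (suc (dbl m)) M × OddShape m ip fp)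

private
  zeckendorf-bounds : ∀ ip0 fp {M n s} → length (ip0 ++ fp) ≡ n → length fp ≡ s →
    NoAdj11 ((true ∷ ip0) ++ fp) → value (true ∷ ip0) fp ≡ (+ M , + 0) →
    F (suc (suc n)) ≤ M * F (suc (suc s)) × M * F (suc (suc s)) < F (suc (suc (suc n)))
  zeckendorf-bounds ip0 fp refl refl na val =
    subst (F (suc (suc (length (ip0 ++ fp)))) ≤_) Z≡ (F≤zeckendorfSum (ip0 ++ fp)) ,
    subst (_< F (suc (suc (suc (length (ip0 ++ fp)))))) Z≡ (zeckendorfSum< ((true ∷ ip0) ++ fp) na)
    where Z≡ = zeckendorfSum≡ (true ∷ ip0) fp val

  length-++ : ∀ (xs ys : List Bool) {m n} → length xs ≡ m → length ys ≡ n → length (xs ++ ys) ≡ m + n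
  length-++ xs ys refl refl = Listₚ.length-++ xs

  reverse≡∷∷⇒ : ∀ (fp : List Bool) {x y r} → reverse fp ≡ x ∷ y ∷ r → fp ≡ reverse r ++ y ∷ x ∷ []
  reverse≡∷∷⇒ fp {x} {y} {r} e =
    trans (sym (Listₚ.reverse-involutive fp)) (trans (cong reverse e) (Listₚ.reverse-++ (x ∷ y ∷ []) r))

  evenShape-intro : ∀ {m} {ip0 fp r : List Bool} → NoAdj11 (true ∷ ip0) → length ip0 ≡ dbl (suc m) →
                    reverse fp ≡ true ∷ false ∷ r → length r ≡ dbl m → EvenShape m (true ∷ ip0) fp
  evenShape-intro {ip0 = false ∷ ip′} {fp} {r} _ |ip0| rev |r| =
    subst (EvenShape _ (true ∷ false ∷ ip′)) (sym (reverse≡∷∷⇒ fp rev))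
          (even-shape ip′ (reverse r) (ℕₚ.suc-injective |ip0|) (trans (Listₚ.length-reverse r) |r|))

  oddShape-intro : ∀ {m} {ip0 fp r : List Bool} → NoAdj11 (true ∷ ip0) → length ip0 ≡ suc (dbl m) →
                   reverse fp ≡ true ∷ false ∷ r → length r ≡ dbl m →
                   (m ≡ 0 ⊎ Σ[ r′ ∈ List Bool ] r ≡ false ∷ r′) → OddShape m (true ∷ ip0) fp
  oddShape-intro {m} {false ∷ ip′} {fp} {r} _ |ip0| rev |r| ends =
    subst (OddShape m (true ∷ false ∷ ip′)) (sym (reverse≡∷∷⇒ fp rev))
          (odd-shape ip′ (reverse r) (ℕₚ.suc-injective |ip0|) (trans (Listₚ.length-reverse r) |r|) (ends-0 ends))
    where
    ends-0 : m ≡ 0 ⊎ Σ[ r′ ∈ List Bool ] r ≡ false ∷ r′ → m ≡ 0 ⊎ Σ[ fp″ ∈ List Bool ] reverse r ≡ fp″ ++ false ∷ []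
    ends-0 (inj₁ m≡0)      = inj₁ m≡0
    ends-0 (inj₂ (r′ , refl)) = inj₂ (reverse r′ , Listₚ.unfold-reverse false r′)

shape : ∀ {M ip fp} → HeadOne ip → LastOneOrEmpty fp → NoAdj11 (ip ++ fp) →
        value ip fp ≡ (+ M , + 0) → 2 ≤ M → Shape M ip fp
shape {M} {true ∷ ip0} {fp} refl lo na val 2≤M = byParity (parity (length ip0))
  where
  open FractionalShape (fractionalShape ip0 fp lo na val 2≤M) renaming (j to j′)
  P = fibSum (true ∷ ip0)
  P-bounds : F (suc (dbl j′)) ≤ P × P < F (suc (suc (suc (dbl j′))))
  P-bounds with altFibSum-10∷-even-bounds j′ r noAdj11 length-r
  ... | lo′ , hi′ = ℤₚ.drop‿+≤+ (subst (+ F (suc (dbl j′)) ℤ.≤_) altFibSum≡ lo′) ,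
                    ℤₚ.drop‿+<+ (subst (ℤ._< + F (suc (suc (suc (dbl j′))))) altFibSum≡ hi′)
  |fp| : length fp ≡ dbl (suc j′)
  |fp| = trans (sym (Listₚ.length-reverse fp)) (trans (cong length reverse-fp) (cong (λ n → suc (suc n)) length-r))
  noAdj11-ip : NoAdj11 (true ∷ ip0)
  noAdj11-ip = NoAdj11-++⁻ˡ (true ∷ ip0) fp na
  byParity : Σ[ j ∈ ℕ ] (length ip0 ≡ dbl j ⊎ length ip0 ≡ suc (dbl j)) → Shape M (true ∷ ip0) fp
  byParity (j , inj₁ |ip0|) with even-index j j′ P-bounds (fibSum-bounds-even j ip0 noAdj11-ip |ip0|)
  ... | refl = inj₁ (j′ , uncurry (Λ-dbl-suc-from-F-bounds j′ M)
                            (zeckendorf-bounds ip0 fp (length-++ ip0 fp |ip0| |fp|) |fp| na val) ,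
                     evenShape-intro noAdj11-ip |ip0| reverse-fp length-r)
  byParity (j , inj₂ |ip0|) with odd-index j j′ P-bounds (fibSum-bounds-odd j ip0 noAdj11-ip |ip0|)
  ... | refl = inj₂ (j , uncurry (Λ-suc-dbl-from-F-bounds j M)
                           (zeckendorf-bounds ip0 fp (length-++ ip0 fp |ip0| |fp|) |fp| na val) ,
                     oddShape-intro noAdj11-ip |ip0| reverse-fp length-r
                       (fraction-ends-001 j r noAdj11 length-r altFibSum≡ (proj₂ (fibSum-bounds-odd j ip0 noAdj11-ip |ip0|))))

Λ-suc⇒2≤ : ∀ k {M} → Λ (suc k) M → 2 ≤ M
Λ-suc⇒2≤ k {M} h = ℕₚ.≤-trans (2≤Λmin-suc k) (proj₁ (Equivalence.to (Λ⇔∈[⟩ (suc k) M refl refl) h))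

shape-even : ∀ m {M ip fp} → Λ (dbl (suc m)) M → HeadOne ip → LastOneOrEmpty fp → NoAdj11 (ip ++ fp) →
             value ip fp ≡ (+ M , + 0) → EvenShape m ip fp
shape-even m hΛ hd lo na val with shape hd lo na val (Λ-suc⇒2≤ (suc (dbl m)) hΛ)
... | inj₁ (m′ , hΛ′ , s) with dbl-injective (Λ-unique hΛ′ hΛ)
...   | refl = s
shape-even m hΛ hd lo na val | inj₂ (m′ , hΛ′ , _) = ⊥-elim (suc-dbl≢dbl m′ (suc m) (Λ-unique hΛ′ hΛ))

shape-odd : ∀ m {M ip fp} → Λ (suc (dbl m)) M → HeadOne ip → LastOneOrEmpty fp → NoAdj11 (ip ++ fp) →
            value ip fp ≡ (+ M , + 0) → OddShape m ip fp
shape-odd m hΛ hd lo na val with shape hd lo na val (Λ-suc⇒2≤ (dbl m) hΛ)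
... | inj₂ (m′ , hΛ′ , s) with dbl-injective (ℕₚ.suc-injective (Λ-unique hΛ′ hΛ))
...   | refl = s
shape-odd m hΛ hd lo na val | inj₁ (m′ , hΛ′ , _) = ⊥-elim (suc-dbl≢dbl m (suc m′) (Λ-unique hΛ hΛ′))

L-dbl≡φ^+φ^- : ∀ K → addφ (mulφ^ (dbl K) oneφ) (divφ^ (dbl K) oneφ) ≡ (+ L (dbl K) , + 0)
L-dbl≡φ^+φ^- K = trans (cong₂ addφ (mulφ^-oneφ a) (divφ^-oneφ a)) (cong₂ _,_ e₁ e₂)
  where
  a = dbl K
  e₁ : + Fpred a ℤ.+ neg^ a (+ F (suc a)) ≡ + L a
  e₁ = trans (cong (ℤ._+_ (+ Fpred a)) (neg^-dbl K (+ F (suc a))))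
             (cong +_ (trans (ℕₚ.+-comm (Fpred a) (F (suc a))) (sym (L≡F+Fpred a))))
  e₂ : + F a ℤ.+ neg^ (suc a) (+ F a) ≡ + 0
  e₂ = trans (cong (λ z → + F a ℤ.+ - z) (neg^-dbl K (+ F a))) (ℤₚ.+-inverseʳ (+ F a))

L-suc-dbl≡φ^-φ^- : ∀ K → addφ (mulφ^ (suc (dbl K)) oneφ) (negφ (divφ^ (suc (dbl K)) oneφ)) ≡ (+ L (suc (dbl K)) , + 0)
L-suc-dbl≡φ^-φ^- K = trans (cong₂ addφ (mulφ^-oneφ a) (cong negφ (divφ^-oneφ a))) (cong₂ _,_ e₁ e₂)
  where
  a = suc (dbl K)
  e₁ : + Fpred a ℤ.+ - neg^ a (+ F (suc a)) ≡ + L a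
  e₁ = trans (cong (ℤ._+_ (+ Fpred a)) (trans (ℤₚ.neg-involutive (neg^ (dbl K) (+ F (suc a)))) (neg^-dbl K (+ F (suc a)))))
             (cong +_ (trans (ℕₚ.+-comm (Fpred a) (F (suc a))) (sym (L≡F+Fpred a))))
  e₂ : + F a ℤ.+ - neg^ (suc a) (+ F a) ≡ + 0
  e₂ = trans (cong (λ z → + F a ℤ.+ - z) (trans (ℤₚ.neg-involutive (neg^ (dbl K) (+ F a))) (neg^-dbl K (+ F a))))
             (ℤₚ.+-inverseʳ (+ F a))

-- Splicing digits into an expansion

addφ-shuffle : ∀ q x i f r y → addφ (addφ (addφ q x) i) (addφ f (addφ r y)) ≡
                               addφ (addφ (addφ q i) (addφ f r)) (addφ x y)
addφ-shuffle (q₁ , q₂) (x₁ , x₂) (i₁ , i₂) (f₁ , f₂) (r₁ , r₂) (y₁ , y₂) =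
  cong₂ _,_ (ring q₁ x₁ i₁ f₁ r₁ y₁) (ring q₂ x₂ i₂ f₂ r₂ y₂)
  where
  ring : ∀ q x i f r y → ((q ℤ.+ x) ℤ.+ i) ℤ.+ (f ℤ.+ (r ℤ.+ y)) ≡ ((q ℤ.+ i) ℤ.+ (f ℤ.+ r)) ℤ.+ (x ℤ.+ y)
  ring = ℤ-solve

value-splice : ∀ P Q R S ip fp {M D} x y → intVal P ≡ addφ (intVal Q) x → fracVal S ≡ addφ (fracVal R) y →
  value (Q ++ ip) (fp ++ R) ≡ (+ M , + 0) → addφ (mulφ^ (length ip) x) (divφ^ (length fp) y) ≡ (+ D , + 0) →
  value (P ++ ip) (fp ++ S) ≡ (+ (M + D) , + 0)
value-splice P Q R S ip fp {M} {D} x y P≡ S≡ valM valD = begin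
  addφ (intVal (P ++ ip)) (fracVal (fp ++ S))
    ≡⟨ cong₂ addφ (intVal-++ P ip) (fracVal-++ fp S) ⟩
  addφ (addφ (mulφ^ a (intVal P)) (intVal ip)) (addφ (fracVal fp) (divφ^ b (fracVal S)))
    ≡⟨ cong₂ (λ u v → addφ (addφ u (intVal ip)) (addφ (fracVal fp) v))
             (trans (cong (mulφ^ a) P≡) (mulφ^-distrib a (intVal Q) x))
             (trans (cong (divφ^ b) S≡) (divφ^-distrib b (fracVal R) y)) ⟩
  addφ (addφ (addφ (mulφ^ a (intVal Q)) (mulφ^ a x)) (intVal ip)) (addφ (fracVal fp) (addφ (divφ^ b (fracVal R)) (divφ^ b y)))
    ≡⟨ addφ-shuffle (mulφ^ a (intVal Q)) (mulφ^ a x) (intVal ip) (fracVal fp) (divφ^ b (fracVal R)) (divφ^ b y) ⟩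
  addφ (addφ (addφ (mulφ^ a (intVal Q)) (intVal ip)) (addφ (fracVal fp) (divφ^ b (fracVal R)))) (addφ (mulφ^ a x) (divφ^ b y))
    ≡⟨ cong₂ addφ (trans (sym (cong₂ addφ (intVal-++ Q ip) (fracVal-++ fp R))) valM) valD ⟩
  (+ (M + D) , + 0)
    ∎
  where
  open ≡-Reasoning
  a = length ip
  b = length fp

consR-pos : ∀ x v → consR (pos x) ⟦ v ⟧ ≡ pos x ∷ ⟦ v ⟧
consR-pos ₀ []      = refl
consR-pos ₁ []      = refl
consR-pos ∙ []      = refl
consR-pos ₀ (₀ ∷ v) = refl
consR-pos ₀ (₁ ∷ v) = refl
consR-pos ₀ (∙ ∷ v) = refl
consR-pos ₁ (₀ ∷ v) = refl
consR-pos ₁ (₁ ∷ v) = refl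
consR-pos ₁ (∙ ∷ v) = refl
consR-pos ∙ (₀ ∷ v) = refl
consR-pos ∙ (₁ ∷ v) = refl
consR-pos ∙ (∙ ∷ v) = refl

foldr-consR-⟦⟧ : ∀ u v → foldr consR ⟦ v ⟧ ⟦ u ⟧ ≡ ⟦ u ++ v ⟧
foldr-consR-⟦⟧ []      v = refl
foldr-consR-⟦⟧ (x ∷ u) v = trans (cong (consR (pos x)) (foldr-consR-⟦⟧ u v)) (consR-pos x (u ++ v))

foldr-consR-⟦++⟧ : ∀ Y u v → foldr consR Y ⟦ u ++ v ⟧ ≡ foldr consR (foldr consR Y ⟦ v ⟧) ⟦ u ⟧
foldr-consR-⟦++⟧ Y u v = trans (cong (foldr consR Y) (Listₚ.map-++ pos u v)) (Listₚ.foldr-++ consR Y ⟦ u ⟧ ⟦ v ⟧)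

-- In the free group, P Q⁻¹ (Q C R) R⁻¹ S = P C S; the two cancellations are supplied by the caller.
reduce-splice : ∀ (P Q C R S : List Letter) (Q⁻¹ R⁻¹S : List Sym) →
  (∀ Z → foldr consR ⟦ Q ++ Z ⟧ Q⁻¹ ≡ ⟦ Z ⟧) → foldr consR (reduce R⁻¹S) ⟦ R ⟧ ≡ ⟦ S ⟧ →
  reduce (⟦ P ⟧ ++ (Q⁻¹ ++ (⟦ Q ++ (C ++ R) ⟧ ++ R⁻¹S))) ≡ ⟦ P ++ (C ++ S) ⟧
reduce-splice P Q C R S Q⁻¹ R⁻¹S cancelQ cancelR = begin
  reduce (⟦ P ⟧ ++ (Q⁻¹ ++ (⟦ Q ++ (C ++ R) ⟧ ++ R⁻¹S)))
    ≡⟨ Listₚ.foldr-++ consR [] ⟦ P ⟧ _ ⟩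
  foldr consR (reduce (Q⁻¹ ++ (⟦ Q ++ (C ++ R) ⟧ ++ R⁻¹S))) ⟦ P ⟧
    ≡⟨ cong (λ z → foldr consR z ⟦ P ⟧) (Listₚ.foldr-++ consR [] Q⁻¹ _) ⟩
  foldr consR (foldr consR (reduce (⟦ Q ++ (C ++ R) ⟧ ++ R⁻¹S)) Q⁻¹) ⟦ P ⟧
    ≡⟨ cong (λ z → foldr consR (foldr consR z Q⁻¹) ⟦ P ⟧) middle ⟩
  foldr consR (foldr consR ⟦ Q ++ (C ++ S) ⟧ Q⁻¹) ⟦ P ⟧
    ≡⟨ cong (λ z → foldr consR z ⟦ P ⟧) (cancelQ (C ++ S)) ⟩
  foldr consR ⟦ C ++ S ⟧ ⟦ P ⟧
    ≡⟨ foldr-consR-⟦⟧ P (C ++ S) ⟩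
  ⟦ P ++ (C ++ S) ⟧
    ∎
  where
  open ≡-Reasoning
  middle : reduce (⟦ Q ++ (C ++ R) ⟧ ++ R⁻¹S) ≡ ⟦ Q ++ (C ++ S) ⟧
  middle = begin
    reduce (⟦ Q ++ (C ++ R) ⟧ ++ R⁻¹S)                           ≡⟨ Listₚ.foldr-++ consR [] ⟦ Q ++ (C ++ R) ⟧ R⁻¹S ⟩
    foldr consR (reduce R⁻¹S) ⟦ Q ++ (C ++ R) ⟧                  ≡⟨ foldr-consR-⟦++⟧ (reduce R⁻¹S) Q (C ++ R) ⟩
    foldr consR (foldr consR (reduce R⁻¹S) ⟦ C ++ R ⟧) ⟦ Q ⟧
                                                                 ≡⟨ cong (λ z → foldr consR z ⟦ Q ⟧) (foldr-consR-⟦++⟧ (reduce R⁻¹S) C R) ⟩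
    foldr consR (foldr consR (foldr consR (reduce R⁻¹S) ⟦ R ⟧) ⟦ C ⟧) ⟦ Q ⟧
                                                                 ≡⟨ cong (λ z → foldr consR (foldr consR z ⟦ C ⟧) ⟦ Q ⟧) cancelR ⟩
    foldr consR (foldr consR ⟦ S ⟧ ⟦ C ⟧) ⟦ Q ⟧                  ≡⟨ cong (λ z → foldr consR z ⟦ Q ⟧) (foldr-consR-⟦⟧ C S) ⟩
    foldr consR ⟦ C ++ S ⟧ ⟦ Q ⟧                                 ≡⟨ foldr-consR-⟦⟧ Q (C ++ S) ⟩
    ⟦ Q ++ (C ++ S) ⟧                                            ∎

expWord-++ : ∀ Q ip fp R → expWord (Q ++ ip) (fp ++ R) ≡ map bit Q ++ (expWord ip fp ++ map bit R)
expWord-++ Q ip fp R = begin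
  map bit (Q ++ ip) ++ ∙ ∷ map bit (fp ++ R)
    ≡⟨ cong₂ (λ a b → a ++ ∙ ∷ b) (Listₚ.map-++ bit Q ip) (Listₚ.map-++ bit fp R) ⟩
  (map bit Q ++ map bit ip) ++ ∙ ∷ (map bit fp ++ map bit R)
    ≡⟨ Listₚ.++-assoc (map bit Q) (map bit ip) _ ⟩
  map bit Q ++ (map bit ip ++ (∙ ∷ map bit fp) ++ map bit R)
    ≡⟨ cong (map bit Q ++_) (sym (Listₚ.++-assoc (map bit ip) (∙ ∷ map bit fp) (map bit R))) ⟩
  map bit Q ++ (expWord ip fp ++ map bit R)
    ∎
  where open ≡-Reasoning

L-dbl-split : ∀ K a b c d → a + b ≡ dbl K → c + d ≡ dbl K →
              addφ (mulφ^ b (mulφ^ a oneφ)) (divφ^ d (divφ^ c oneφ)) ≡ (+ L (dbl K) , + 0)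
L-dbl-split K a b c d a+b c+d =
  trans (cong₂ addφ (trans (sym (mulφ^-+ a b oneφ)) (cong (λ n → mulφ^ n oneφ) a+b))
                    (trans (sym (divφ^-+ c d oneφ)) (cong (λ n → divφ^ n oneφ) c+d)))
        (L-dbl≡φ^+φ^- K)

L-suc-dbl-split : ∀ K a b c d → a + b ≡ suc (dbl K) → c + d ≡ suc (dbl K) →
                  addφ (mulφ^ b (mulφ^ a oneφ)) (divφ^ d (negφ (divφ^ c oneφ))) ≡ (+ L (suc (dbl K)) , + 0)
L-suc-dbl-split K a b c d a+b c+d =
  trans (cong₂ addφ (trans (sym (mulφ^-+ a b oneφ)) (cong (λ n → mulφ^ n oneφ) a+b))
                    (trans (divφ^-negφ d (divφ^ c oneφ))
                           (cong negφ (trans (sym (divφ^-+ c d oneφ)) (cong (λ n → divφ^ n oneφ) c+d)))))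
        (L-suc-dbl≡φ^-φ^- K)

betaEq-splice : ∀ {N D} (P Q R S ip fp : List Bool) (Q⁻¹ R⁻¹S : List Sym) x y →
  D ≤ N → value (Q ++ ip) (fp ++ R) ≡ (+ (N ∸ D) , + 0) →
  intVal P ≡ addφ (intVal Q) x → fracVal S ≡ addφ (fracVal R) y →
  addφ (mulφ^ (length ip) x) (divφ^ (length fp) y) ≡ (+ D , + 0) →
  HeadOne (P ++ ip) → LastOneOrEmpty (fp ++ S) →
  NoAdj11 P → ¬ LastOne P → NoAdj11 (ip ++ (fp ++ S)) →
  (∀ Z → foldr consR ⟦ map bit Q ++ Z ⟧ Q⁻¹ ≡ ⟦ Z ⟧) → foldr consR (reduce R⁻¹S) ⟦ map bit R ⟧ ≡ ⟦ map bit S ⟧ →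
  BetaEq N (reduce (⟦ map bit P ⟧ ++ (Q⁻¹ ++ (⟦ expWord (Q ++ ip) (fp ++ R) ⟧ ++ R⁻¹S))))
betaEq-splice {N} {D} P Q R S ip fp Q⁻¹ R⁻¹S x y D≤N valM P≡ S≡ valD hd lo naP P-ends-0 na cancelQ cancelR =
  expWord (P ++ ip) (fp ++ S) ,
  (P ++ ip , fp ++ S , hd , lo ,
   subst NoAdj11 (sym (Listₚ.++-assoc P ip (fp ++ S))) (NoAdj11-++ P _ naP na (λ l _ → P-ends-0 l)) , valN , refl) ,
  (begin
    reduce (⟦ map bit P ⟧ ++ (Q⁻¹ ++ (⟦ expWord (Q ++ ip) (fp ++ R) ⟧ ++ R⁻¹S)))
      ≡⟨ cong (λ w → reduce (⟦ map bit P ⟧ ++ (Q⁻¹ ++ (⟦ w ⟧ ++ R⁻¹S)))) (expWord-++ Q ip fp R) ⟩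
    reduce (⟦ map bit P ⟧ ++ (Q⁻¹ ++ (⟦ map bit Q ++ (expWord ip fp ++ map bit R) ⟧ ++ R⁻¹S)))
      ≡⟨ reduce-splice (map bit P) (map bit Q) (expWord ip fp) (map bit R) (map bit S) Q⁻¹ R⁻¹S cancelQ cancelR ⟩
    ⟦ map bit P ++ (expWord ip fp ++ map bit S) ⟧
      ≡⟨ cong ⟦_⟧ (sym (expWord-++ P ip fp S)) ⟩
    ⟦ expWord (P ++ ip) (fp ++ S) ⟧
      ∎)
  where
  open ≡-Reasoning
  valN : value (P ++ ip) (fp ++ S) ≡ (+ N , + 0)
  valN = trans (value-splice P Q R S ip fp x y P≡ S≡ valM valD) (cong (λ n → (+ n , + 0)) (ℕₚ.m∸n+n≡m D≤N))

NoAdj11-resuffix : ∀ ip fp R S → NoAdj11 (ip ++ (fp ++ R)) → NoAdj11 S → NoAdj11 (ip ++ (fp ++ false ∷ S))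
NoAdj11-resuffix ip fp R S h hS = subst NoAdj11 (Listₚ.++-assoc ip fp (false ∷ S))
  (NoAdj11-++-0∷ (ip ++ fp) S (NoAdj11-++⁻ˡ (ip ++ fp) R (subst NoAdj11 (sym (Listₚ.++-assoc ip fp R)) h)) hS)

-- The six formulas: expansion-odd-x is (i)(x) and expansion-even-x is (ii)(x), for n = m + 1.

expansion-even-c : ∀ m N → N ∈Λ (dbl (suc m)) + L (suc (suc (dbl (suc m)))) →
  ∀ w → IsBeta (N ∸ L (suc (suc (dbl (suc m))))) w →
  BetaEq N (prod (⟦ ₁ ∷ ₀ ∷ [] ⟧ ∷ ⟦ w ⟧ ∷ ⟦ ₀ ∷ ₁ ∷ [] ⟧ ∷ []))
expansion-even-c m N (L≤N , hΛ) w (ip , fp , hd , lo , na , val , refl) with shape-even m hΛ hd lo na val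
... | even-shape ip′ fp′ |ip′| |fp′| =
  betaEq-splice (true ∷ false ∷ []) [] (false ∷ true ∷ []) (false ∷ true ∷ false ∷ true ∷ [])
    (true ∷ false ∷ ip′) fp′ [] (⟦ ₀ ∷ ₁ ∷ [] ⟧ ++ []) (mulφ^ 1 oneφ) (divφ^ 4 oneφ) L≤N val refl refl
    (L-dbl-split (suc (suc m)) 1 _ 4 _ (cong (λ n → 1 + suc (suc n)) |ip′|) (cong (_+_ 4) |fp′|))
    refl (LastOneOrEmpty-++ fp′ false _ refl)
    tt (λ ()) (NoAdj11-resuffix (true ∷ false ∷ ip′) fp′ (false ∷ true ∷ []) (true ∷ false ∷ true ∷ []) na tt)
    (λ _ → refl) refl

expansion-even-b : ∀ m N → N ∈Λ (suc (dbl m)) + L (suc (suc (dbl (suc m)))) →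
  ∀ w → IsBeta (N ∸ L (suc (suc (dbl (suc m))))) w →
  BetaEq N (prod (⟦ ₁ ∷ ₀ ∷ ₀ ∷ [] ⟧ ∷ ⟦ w ⟧ ∷ ⟦ ₀ ∷ ₁ ∷ [] ⟧ ∷ []))
expansion-even-b m N (L≤N , hΛ) w (ip , fp , hd , lo , na , val , refl) with shape-odd m hΛ hd lo na val
... | odd-shape ip′ fp′ |ip′| |fp′| _ =
  betaEq-splice (true ∷ false ∷ false ∷ []) [] (false ∷ true ∷ []) (false ∷ true ∷ false ∷ true ∷ [])
    (true ∷ false ∷ ip′) fp′ [] (⟦ ₀ ∷ ₁ ∷ [] ⟧ ++ []) (mulφ^ 2 oneφ) (divφ^ 4 oneφ) L≤N val refl refl
    (L-dbl-split (suc (suc m)) 2 _ 4 _ (cong (λ n → 2 + suc (suc n)) |ip′|) (cong (_+_ 4) |fp′|))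
    refl (LastOneOrEmpty-++ fp′ false _ refl)
    tt (λ ()) (NoAdj11-resuffix (true ∷ false ∷ ip′) fp′ (false ∷ true ∷ []) (true ∷ false ∷ true ∷ []) na tt)
    (λ _ → refl) refl

expansion-even-a : ∀ m N → N ∈Λ (dbl (suc m)) + L (suc (dbl (suc m))) →
  ∀ w → IsBeta (N ∸ L (suc (dbl (suc m)))) w →
  BetaEq N (prod (⟦ ₁ ∷ ₀ ∷ ₀ ∷ ₀ ∷ [] ⟧ ∷ ⟦ ₁ ∷ ₀ ∷ [] ⟧⁻¹ ∷ ⟦ w ⟧
                  ∷ ⟦ ₀ ∷ ₁ ∷ [] ⟧⁻¹ ∷ ⟦ ₀ ∷ ₀ ∷ ₀ ∷ ₁ ∷ [] ⟧ ∷ []))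
expansion-even-a m N (L≤N , hΛ) w (ip , fp , hd , lo , na , val , refl) with shape-even m hΛ hd lo na val
... | even-shape ip′ fp′ |ip′| |fp′| =
  betaEq-splice (true ∷ false ∷ false ∷ false ∷ []) (true ∷ false ∷ []) (false ∷ true ∷ []) (false ∷ false ∷ false ∷ true ∷ [])
    ip′ fp′ ⟦ ₁ ∷ ₀ ∷ [] ⟧⁻¹ (⟦ ₀ ∷ ₁ ∷ [] ⟧⁻¹ ++ (⟦ ₀ ∷ ₀ ∷ ₀ ∷ ₁ ∷ [] ⟧ ++ []))
    (mulφ^ 2 oneφ) (negφ (divφ^ 3 oneφ)) L≤N val refl refl
    (L-suc-dbl-split (suc m) 2 _ 3 _ (cong (_+_ 2) |ip′|) (cong (_+_ 3) |fp′|))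
    refl (LastOneOrEmpty-++ fp′ false _ refl)
    tt (λ ()) (NoAdj11-resuffix ip′ fp′ (false ∷ true ∷ []) (false ∷ false ∷ true ∷ [])
                 (NoAdj11-10∷⁻ (ip′ ++ (fp′ ++ false ∷ true ∷ [])) na) tt)
    (λ _ → refl) refl

expansion-odd-c : ∀ m N → N ∈Λ (suc (dbl m)) + L (suc (dbl (suc m))) →
  ∀ w → IsBeta (N ∸ L (suc (dbl (suc m)))) w →
  BetaEq N (prod (⟦ ₁ ∷ ₀ ∷ [] ⟧ ∷ ⟦ w ⟧ ∷ ⟦ ₀ ∷ ₁ ∷ [] ⟧⁻¹ ∷ ⟦ ₀ ∷ ₀ ∷ ₀ ∷ ₁ ∷ [] ⟧ ∷ []))
expansion-odd-c m N (L≤N , hΛ) w (ip , fp , hd , lo , na , val , refl) with shape-odd m hΛ hd lo na val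
... | odd-shape ip′ fp′ |ip′| |fp′| _ =
  betaEq-splice (true ∷ false ∷ []) [] (false ∷ true ∷ []) (false ∷ false ∷ false ∷ true ∷ [])
    (true ∷ false ∷ ip′) fp′ [] (⟦ ₀ ∷ ₁ ∷ [] ⟧⁻¹ ++ (⟦ ₀ ∷ ₀ ∷ ₀ ∷ ₁ ∷ [] ⟧ ++ []))
    (mulφ^ 1 oneφ) (negφ (divφ^ 3 oneφ)) L≤N val refl refl
    (L-suc-dbl-split (suc m) 1 _ 3 _ (cong (λ n → 1 + suc (suc n)) |ip′|) (cong (_+_ 3) |fp′|))
    refl (LastOneOrEmpty-++ fp′ false _ refl)
    tt (λ ()) (NoAdj11-resuffix (true ∷ false ∷ ip′) fp′ (false ∷ true ∷ []) (false ∷ false ∷ true ∷ []) na tt)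
    (λ _ → refl) refl

Λ0-empty : ∀ {M} → ¬ Λ 0 M
Λ0-empty (2≤M , M≤1) = ℕₚ.<⇒≱ (s≤s (s≤s z≤n)) (ℕₚ.≤-trans 2≤M M≤1)

expansion-odd-b : ∀ m N → N ∈Λ (dbl m) + L (suc (dbl (suc m))) →
  ∀ w → IsBeta (N ∸ L (suc (dbl (suc m)))) w →
  BetaEq N (prod (⟦ ₁ ∷ ₀ ∷ ₀ ∷ [] ⟧ ∷ ⟦ w ⟧
                  ∷ ⟦ ₀ ∷ ₁ ∷ [] ⟧⁻¹ ∷ ⟦ ₀ ∷ ₀ ∷ ₁ ∷ ₀ ∷ ₀ ∷ ₁ ∷ [] ⟧ ∷ []))
expansion-odd-b zero     N (_ , hΛ) _ _ = ⊥-elim (Λ0-empty hΛ)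
expansion-odd-b (suc m′) N (L≤N , hΛ) w (ip , fp , hd , lo , na , val , refl) with shape-even m′ hΛ hd lo na val
... | even-shape ip′ fp′ |ip′| |fp′| =
  betaEq-splice (true ∷ false ∷ false ∷ []) [] (false ∷ true ∷ []) (false ∷ false ∷ true ∷ false ∷ false ∷ true ∷ [])
    (true ∷ false ∷ ip′) fp′ [] (⟦ ₀ ∷ ₁ ∷ [] ⟧⁻¹ ++ (⟦ ₀ ∷ ₀ ∷ ₁ ∷ ₀ ∷ ₀ ∷ ₁ ∷ [] ⟧ ++ []))
    (mulφ^ 2 oneφ) (negφ (divφ^ 5 oneφ)) L≤N val refl refl
    (L-suc-dbl-split (suc (suc m′)) 2 _ 5 _ (cong (λ n → 2 + suc (suc n)) |ip′|) (cong (_+_ 5) |fp′|))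
    refl (LastOneOrEmpty-++ fp′ false _ refl)
    tt (λ ()) (NoAdj11-resuffix (true ∷ false ∷ ip′) fp′ (false ∷ true ∷ []) (false ∷ true ∷ false ∷ false ∷ true ∷ []) na tt)
    (λ _ → refl) refl

-- Here the new suffix 1001 starts with a one, which is safe because the fraction of β (N - L (2n)) ends in 001.
NoAdj11-odd-a : ∀ m ip′ fp′ → length ip′ ≡ dbl m → length fp′ ≡ dbl m →
                (m ≡ 0 ⊎ Σ[ fp″ ∈ List Bool ] fp′ ≡ fp″ ++ false ∷ []) →
                NoAdj11 (ip′ ++ (fp′ ++ false ∷ true ∷ [])) → NoAdj11 (ip′ ++ (fp′ ++ true ∷ false ∷ false ∷ true ∷ []))
NoAdj11-odd-a m ip′ fp′ _ _ (inj₂ (fp″ , refl)) h =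
  subst (λ z → NoAdj11 (ip′ ++ z)) (sym (Listₚ.++-assoc fp″ (false ∷ []) (true ∷ false ∷ false ∷ true ∷ [])))
    (NoAdj11-resuffix ip′ fp″ (false ∷ false ∷ true ∷ []) (true ∷ false ∷ false ∷ true ∷ [])
      (subst (λ z → NoAdj11 (ip′ ++ z)) (Listₚ.++-assoc fp″ (false ∷ []) (false ∷ true ∷ [])) h) tt)
NoAdj11-odd-a zero [] [] _ _ (inj₁ refl) _ = tt

expansion-odd-a : ∀ m N → N ∈Λ (suc (dbl m)) + L (dbl (suc m)) →
  ∀ w → IsBeta (N ∸ L (dbl (suc m))) w →
  BetaEq N (prod (⟦ ₁ ∷ ₀ ∷ ₀ ∷ ₀ ∷ [] ⟧ ∷ ⟦ ₁ ∷ ₀ ∷ [] ⟧⁻¹ ∷ ⟦ w ⟧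
                  ∷ ⟦ ₀ ∷ ₁ ∷ [] ⟧⁻¹ ∷ ⟦ ₁ ∷ ₀ ∷ ₀ ∷ ₁ ∷ [] ⟧ ∷ []))
expansion-odd-a m N (L≤N , hΛ) w (ip , fp , hd , lo , na , val , refl) with shape-odd m hΛ hd lo na val
... | odd-shape ip′ fp′ |ip′| |fp′| ends =
  betaEq-splice (true ∷ false ∷ false ∷ false ∷ []) (true ∷ false ∷ []) (false ∷ true ∷ []) (true ∷ false ∷ false ∷ true ∷ [])
    ip′ fp′ ⟦ ₁ ∷ ₀ ∷ [] ⟧⁻¹ (⟦ ₀ ∷ ₁ ∷ [] ⟧⁻¹ ++ (⟦ ₁ ∷ ₀ ∷ ₀ ∷ ₁ ∷ [] ⟧ ++ []))
    (mulφ^ 2 oneφ) (divφ^ 2 oneφ) L≤N val refl refl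
    (L-dbl-split (suc m) 2 _ 2 _ (cong (_+_ 2) |ip′|) (cong (_+_ 2) |fp′|))
    refl (LastOneOrEmpty-++ fp′ true _ refl)
    tt (λ ()) (NoAdj11-odd-a m ip′ fp′ |ip′| |fp′| ends (NoAdj11-10∷⁻ (ip′ ++ (fp′ ++ false ∷ true ∷ [])) na))
    (λ _ → refl) refl

Λ-split₃ : ∀ K k₁ x₁ k₂ x₂ k₃ x₃ →
  Λmin K ≡ Λmin k₁ + x₁ → Λmin (suc k₁) + x₁ ≡ Λmin k₂ + x₂ →
  Λmin (suc k₂) + x₂ ≡ Λmin k₃ + x₃ → Λmin (suc k₃) + x₃ ≡ Λmin (suc K) →
  ∀ N → Λ K N ⇔ (N ∈Λ k₁ + x₁ ⊎ N ∈Λ k₂ + x₂ ⊎ N ∈Λ k₃ + x₃)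
Λ-split₃ K k₁ x₁ k₂ x₂ k₃ x₃ e₀ e₁ e₂ e₃ N = pieces ⇔-∘ (split ⇔-∘ Λ⇔∈[⟩ K N e₀ (sym e₃))
  where
  split = ∈[⟩-split₃ (ℕₚ.+-monoˡ-≤ x₁ (Λmin-≤-suc k₁))
                     (subst (_≤ Λmin (suc k₂) + x₂) (sym e₁) (ℕₚ.+-monoˡ-≤ x₂ (Λmin-≤-suc k₂)))
                     (subst (_≤ Λmin (suc k₃) + x₃) (sym e₂) (ℕₚ.+-monoˡ-≤ x₃ (Λmin-≤-suc k₃))) N
  pieces = ⇔-sym (∈Λ+⇔∈[⟩ k₁ x₁ N refl refl) ⊎-⇔
           (⇔-sym (∈Λ+⇔∈[⟩ k₂ x₂ N (sym e₁) refl) ⊎-⇔ ⇔-sym (∈Λ+⇔∈[⟩ k₃ x₃ N (sym e₂) refl))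

∈Λ+-ordered : ∀ k₁ x₁ k₂ x₂ → Λmin (suc k₁) + x₁ ≡ Λmin k₂ + x₂ →
              ∀ a b → a ∈Λ k₁ + x₁ → b ∈Λ k₂ + x₂ → a < b
∈Λ+-ordered k₁ x₁ k₂ x₂ e a b ha hb =
  ℕₚ.<-≤-trans (proj₂ (Equivalence.to (∈Λ+⇔∈[⟩ k₁ x₁ a refl refl) ha)) (proj₁ (Equivalence.to (∈Λ+⇔∈[⟩ k₂ x₂ b (sym e) refl) hb))

PartI : ℕ → Set
PartI k =
  (∀ N → Λ (suc k) N ⇔
     (N ∈Λ (k ∸ 1) + L k ⊎ N ∈Λ (k ∸ 2) + L (suc k) ⊎ N ∈Λ (k ∸ 1) + L (suc k))) ×
  (∀ a b → a ∈Λ (k ∸ 1) + L k → b ∈Λ (k ∸ 2) + L (suc k) → a < b) ×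
  (∀ b c → b ∈Λ (k ∸ 2) + L (suc k) → c ∈Λ (k ∸ 1) + L (suc k) → b < c) ×
  (∀ N → N ∈Λ (k ∸ 1) + L k → ∀ w → IsBeta (N ∸ L k) w →
     BetaEq N (prod (⟦ ₁ ∷ ₀ ∷ ₀ ∷ ₀ ∷ [] ⟧ ∷ ⟦ ₁ ∷ ₀ ∷ [] ⟧⁻¹ ∷ ⟦ w ⟧
                     ∷ ⟦ ₀ ∷ ₁ ∷ [] ⟧⁻¹ ∷ ⟦ ₁ ∷ ₀ ∷ ₀ ∷ ₁ ∷ [] ⟧ ∷ []))) ×
  (∀ N → N ∈Λ (k ∸ 2) + L (suc k) → ∀ w → IsBeta (N ∸ L (suc k)) w →
     BetaEq N (prod (⟦ ₁ ∷ ₀ ∷ ₀ ∷ [] ⟧ ∷ ⟦ w ⟧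
                     ∷ ⟦ ₀ ∷ ₁ ∷ [] ⟧⁻¹ ∷ ⟦ ₀ ∷ ₀ ∷ ₁ ∷ ₀ ∷ ₀ ∷ ₁ ∷ [] ⟧ ∷ []))) ×
  (∀ N → N ∈Λ (k ∸ 1) + L (suc k) → ∀ w → IsBeta (N ∸ L (suc k)) w →
     BetaEq N (prod (⟦ ₁ ∷ ₀ ∷ [] ⟧ ∷ ⟦ w ⟧
                     ∷ ⟦ ₀ ∷ ₁ ∷ [] ⟧⁻¹ ∷ ⟦ ₀ ∷ ₀ ∷ ₀ ∷ ₁ ∷ [] ⟧ ∷ [])))

PartII : ℕ → Set
PartII k =
  (∀ N → Λ (suc (suc k)) N ⇔
     (N ∈Λ k + L (suc k) ⊎ N ∈Λ (k ∸ 1) + L (suc (suc k)) ⊎ N ∈Λ k + L (suc (suc k)))) ×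
  (∀ a b → a ∈Λ k + L (suc k) → b ∈Λ (k ∸ 1) + L (suc (suc k)) → a < b) ×
  (∀ b c → b ∈Λ (k ∸ 1) + L (suc (suc k)) → c ∈Λ k + L (suc (suc k)) → b < c) ×
  (∀ N → N ∈Λ k + L (suc k) → ∀ w → IsBeta (N ∸ L (suc k)) w →
     BetaEq N (prod (⟦ ₁ ∷ ₀ ∷ ₀ ∷ ₀ ∷ [] ⟧ ∷ ⟦ ₁ ∷ ₀ ∷ [] ⟧⁻¹ ∷ ⟦ w ⟧
                     ∷ ⟦ ₀ ∷ ₁ ∷ [] ⟧⁻¹ ∷ ⟦ ₀ ∷ ₀ ∷ ₀ ∷ ₁ ∷ [] ⟧ ∷ []))) ×
  (∀ N → N ∈Λ (k ∸ 1) + L (suc (suc k)) → ∀ w → IsBeta (N ∸ L (suc (suc k))) w →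
     BetaEq N (prod (⟦ ₁ ∷ ₀ ∷ ₀ ∷ [] ⟧ ∷ ⟦ w ⟧ ∷ ⟦ ₀ ∷ ₁ ∷ [] ⟧ ∷ []))) ×
  (∀ N → N ∈Λ k + L (suc (suc k)) → ∀ w → IsBeta (N ∸ L (suc (suc k))) w →
     BetaEq N (prod (⟦ ₁ ∷ ₀ ∷ [] ⟧ ∷ ⟦ w ⟧ ∷ ⟦ ₀ ∷ ₁ ∷ [] ⟧ ∷ [])))

-- With x = L (2m) and y = L (2m+1), every endpoint is a linear form in x and y.
module Endpoints (m : ℕ) where
  private
    x = L (dbl m)
    y = L (suc (dbl m))
    k = dbl (suc m)

  odd₀ : Λmin (suc k) ≡ Λmin (suc (dbl m)) + L k
  odd₀ = trans (Λmin-suc-dbl (suc m)) (trans (ring x y) (cong (_+ L k) (sym (Λmin-suc-dbl m))))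
    where
    ring : ∀ x y → suc ((y + x) + y) ≡ suc y + (y + x)
    ring = ℕ-solve

  odd₁ : Λmin k + L k ≡ Λmin (dbl m) + L (suc k)
  odd₁ = trans (cong (_+ L k) (Λmin-dbl (suc m))) (trans (ring x y) (cong (_+ L (suc k)) (sym (Λmin-dbl m))))
    where
    ring : ∀ x y → (y + x) + (y + x) ≡ x + ((y + x) + y)
    ring = ℕ-solve

  odd₃ : Λmin k + L (suc k) ≡ Λmin (suc (suc k))
  odd₃ = trans (cong (_+ L (suc k)) (Λmin-dbl (suc m))) (trans (ring x y) (sym (Λmin-dbl (suc (suc m)))))
    where
    ring : ∀ x y → (y + x) + ((y + x) + y) ≡ ((y + x) + y) + (y + x)
    ring = ℕ-solve

  even₁ : Λmin (suc k) + L (suc k) ≡ Λmin (suc (dbl m)) + L (suc (suc k))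
  even₁ = trans (cong (_+ L (suc k)) (Λmin-suc-dbl (suc m)))
                (trans (ring x y) (cong (_+ L (suc (suc k))) (sym (Λmin-suc-dbl m))))
    where
    ring : ∀ x y → suc ((y + x) + y) + ((y + x) + y) ≡ suc y + (((y + x) + y) + (y + x))
    ring = ℕ-solve

  even₃ : Λmin (suc k) + L (suc (suc k)) ≡ Λmin (suc (suc (suc k)))
  even₃ = trans (cong (_+ L (suc (suc k))) (Λmin-suc-dbl (suc m)))
                (trans (ring x y) (sym (Λmin-suc-dbl (suc (suc m)))))
    where
    ring : ∀ x y → suc ((y + x) + y) + (((y + x) + y) + (y + x)) ≡ suc ((((y + x) + y) + (y + x)) + ((y + x) + y))
    ring = ℕ-solve

partI : ∀ m → PartI (dbl (suc m))
partI m =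
  (λ N → Λ-split₃ (suc k) (suc (dbl m)) (L k) (dbl m) (L (suc k)) (suc (dbl m)) (L (suc k)) odd₀ odd₁ refl odd₃ N) ,
  ∈Λ+-ordered (suc (dbl m)) (L k) (dbl m) (L (suc k)) odd₁ ,
  ∈Λ+-ordered (dbl m) (L (suc k)) (suc (dbl m)) (L (suc k)) refl ,
  expansion-odd-a m , expansion-odd-b m , expansion-odd-c m
  where
  open Endpoints m
  k = dbl (suc m)

partII : ∀ m → PartII (dbl (suc m))
partII m =
  (λ N → Λ-split₃ (suc (suc k)) k (L (suc k)) (suc (dbl m)) (L (suc (suc k))) k (L (suc (suc k))) (sym odd₃) even₁ refl even₃ N) ,
  ∈Λ+-ordered k (L (suc k)) (suc (dbl m)) (L (suc (suc k))) even₁ ,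
  ∈Λ+-ordered (suc (dbl m)) (L (suc (suc k))) k (L (suc (suc k))) refl ,
  expansion-even-a m , expansion-even-b m , expansion-even-c m
  where
  open Endpoints m
  k = dbl (suc m)

theorem3p3 :
  (∀ (n : ℕ) → 1 ≤ n →
    (∀ N → Λ (suc (2 * n)) N ⇔
       (N ∈Λ (2 * n ∸ 1) + L (2 * n) ⊎ N ∈Λ (2 * n ∸ 2) + L (suc (2 * n))
          ⊎ N ∈Λ (2 * n ∸ 1) + L (suc (2 * n)))) ×
    (∀ a b → a ∈Λ (2 * n ∸ 1) + L (2 * n) → b ∈Λ (2 * n ∸ 2) + L (suc (2 * n)) → a < b) ×
    (∀ b c → b ∈Λ (2 * n ∸ 2) + L (suc (2 * n)) → c ∈Λ (2 * n ∸ 1) + L (suc (2 * n)) → b < c) ×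
    (∀ N → N ∈Λ (2 * n ∸ 1) + L (2 * n) → ∀ w → IsBeta (N ∸ L (2 * n)) w →
       BetaEq N (prod (⟦ ₁ ∷ ₀ ∷ ₀ ∷ ₀ ∷ [] ⟧ ∷ ⟦ ₁ ∷ ₀ ∷ [] ⟧⁻¹ ∷ ⟦ w ⟧
                       ∷ ⟦ ₀ ∷ ₁ ∷ [] ⟧⁻¹ ∷ ⟦ ₁ ∷ ₀ ∷ ₀ ∷ ₁ ∷ [] ⟧ ∷ []))) ×
    (∀ N → N ∈Λ (2 * n ∸ 2) + L (suc (2 * n)) → ∀ w → IsBeta (N ∸ L (suc (2 * n))) w →
       BetaEq N (prod (⟦ ₁ ∷ ₀ ∷ ₀ ∷ [] ⟧ ∷ ⟦ w ⟧
                       ∷ ⟦ ₀ ∷ ₁ ∷ [] ⟧⁻¹ ∷ ⟦ ₀ ∷ ₀ ∷ ₁ ∷ ₀ ∷ ₀ ∷ ₁ ∷ [] ⟧ ∷ []))) ×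
    (∀ N → N ∈Λ (2 * n ∸ 1) + L (suc (2 * n)) → ∀ w → IsBeta (N ∸ L (suc (2 * n))) w →
       BetaEq N (prod (⟦ ₁ ∷ ₀ ∷ [] ⟧ ∷ ⟦ w ⟧
                       ∷ ⟦ ₀ ∷ ₁ ∷ [] ⟧⁻¹ ∷ ⟦ ₀ ∷ ₀ ∷ ₀ ∷ ₁ ∷ [] ⟧ ∷ []))))
  ×
  (∀ (n : ℕ) → 1 ≤ n →
    (∀ N → Λ (suc (suc (2 * n))) N ⇔
       (N ∈Λ (2 * n) + L (suc (2 * n)) ⊎ N ∈Λ (2 * n ∸ 1) + L (suc (suc (2 * n)))
          ⊎ N ∈Λ (2 * n) + L (suc (suc (2 * n))))) ×
    (∀ a b → a ∈Λ (2 * n) + L (suc (2 * n)) → b ∈Λ (2 * n ∸ 1) + L (suc (suc (2 * n))) → a < b) ×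
    (∀ b c → b ∈Λ (2 * n ∸ 1) + L (suc (suc (2 * n))) → c ∈Λ (2 * n) + L (suc (suc (2 * n))) → b < c) ×
    (∀ N → N ∈Λ (2 * n) + L (suc (2 * n)) → ∀ w → IsBeta (N ∸ L (suc (2 * n))) w →
       BetaEq N (prod (⟦ ₁ ∷ ₀ ∷ ₀ ∷ ₀ ∷ [] ⟧ ∷ ⟦ ₁ ∷ ₀ ∷ [] ⟧⁻¹ ∷ ⟦ w ⟧
                       ∷ ⟦ ₀ ∷ ₁ ∷ [] ⟧⁻¹ ∷ ⟦ ₀ ∷ ₀ ∷ ₀ ∷ ₁ ∷ [] ⟧ ∷ []))) ×
    (∀ N → N ∈Λ (2 * n ∸ 1) + L (suc (suc (2 * n))) → ∀ w → IsBeta (N ∸ L (suc (suc (2 * n)))) w →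
       BetaEq N (prod (⟦ ₁ ∷ ₀ ∷ ₀ ∷ [] ⟧ ∷ ⟦ w ⟧ ∷ ⟦ ₀ ∷ ₁ ∷ [] ⟧ ∷ []))) ×
    (∀ N → N ∈Λ (2 * n) + L (suc (suc (2 * n))) → ∀ w → IsBeta (N ∸ L (suc (suc (2 * n)))) w →
       BetaEq N (prod (⟦ ₁ ∷ ₀ ∷ [] ⟧ ∷ ⟦ w ⟧ ∷ ⟦ ₀ ∷ ₁ ∷ [] ⟧ ∷ []))))
theorem3p3 =
  (λ { (suc m) _ → subst PartI  (sym (2*≡dbl (suc m))) (partI m) }) ,
  (λ { (suc m) _ → subst PartII (sym (2*≡dbl (suc m))) (partII m) })
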